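{- Let $B$ be a finite set of permutations and let $\|B\|_\infty$ denote the maximum length of a permutation in $B$. Let $\pi\in S_k$ and $r\in[k]$. Then the entry $\pi(r)$ is ES$^+$-reducible for $\pi$ with respect to $B$ if and only if $$|Z(B;\pi;\mathbf{g})|=|Z(B;d_r(\pi);d_r(\mathbf{g}))|$$ for all $\mathbf{g}\in\mathcal{G}(\pi)$ with $\|\mathbf{g}\|\le\|B\|_\infty-1$.
   Context: Permutations are written in one-line notation; $\operatorname{st}(w)$ (standardization) of a sequence $w$ of distinct natural numbers is the unique permutation order isomorphic to $w$. A permutation contains $\beta$ if it has a subsequence order isomorphic to $\beta$, and avoids $\beta$ otherwise. For $\pi\in S_k$ and a gap vector $\mathbf{g}=(g_1,\dots,g_{k+1})\in\mathbb{N}^{k+1}$ with $\|\mathbf{g}\|=g_1+\cdots+g_{k+1}$, let $Z(B;\pi;\mathbf{g})$ be the set of permutations $p$ of length $k+\|\mathbf{g}\|$ avoiding every element of $B$ such that $p(g_1+\cdots+g_i+i)=\pi(i)$ for $i=1,\dots,k$. For $r\in[k]$, $d_r(\pi)=\operatorname{st}(\pi \text{ with the entry }\pi(r)\text{ deleted})$ and $d_r(\mathbf{g})=(g_1,\dots,g_{r-1},g_r+g_{r+1},g_{r+2},\dots,g_{k+1})$. Let $\mathcal{G}(\pi)=\{\mathbf{g}\in\mathbb{N}^{k+1}: Z(B;\pi;\mathbf{g})\neq\emptyset\}$. The entry $\pi(r)$ is ES$^+$-reducible for $\pi$ with respect to $B$ if $|Z(B;\pi;\mathbf{g})|=|Z(B;d_r(\pi);d_r(\mathbf{g}))|$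 whenever $Z(B;\pi;\mathbf{g})$ is nonempty. -}

module Defs where

open import Data.Nat using (ℕ; zero; suc; _+_; _≤_; _<_; _⊔_; _≤?_)
open import Data.Nat.Properties using (_≟_)
open import Data.List using (List; []; _∷_; length; map; filter; take; concatMap; foldr; upTo; _++_)
open import Data.List.Properties using (≡-dec)
open import Data.Nat.ListAction using (sum)
open import Data.List.Relation.Unary.All using (All; all?)
open import Data.List.Relation.Unary.Unique.Propositional using (Unique)
open import Data.List.Relation.Unary.Unique.DecPropositional _≟_ using (unique?)
open import Data.Maybe using (Maybe; just; nothing)
open import Data.Maybe.Properties using () renaming (≡-dec to ≡-decMaybe)
open import Data.Product using (_×_; _,_)
open import Relation.Nullary using (Dec; ¬_; ¬?)
open import Relation.Nullary.Decidable using (_×-dec_)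
open import Relation.Binary.PropositionalEquality using (_≡_)
import Data.List.Membership.DecPropositional as DecMem

-- Permutations are lists of naturals in one-line notation, with values 1..n.

IsPerm : List ℕ → Set
IsPerm p = Unique p × All (λ x → 1 ≤ x × x ≤ length p) p

isPerm? : (p : List ℕ) → Dec (IsPerm p)
isPerm? p = unique? p ×-dec all? (λ x → (1 ≤? x) ×-dec (x ≤? length p)) p

-- 1-based lookup: at w i = w(i) (nothing if out of range)
at : List ℕ → ℕ → Maybe ℕ
at []       _             = nothing
at (x ∷ w)  zero          = nothing
at (x ∷ w)  (suc zero)    = just x
at (x ∷ w)  (suc (suc i)) = at w (suc i)

countLess : ℕ → List ℕ → ℕ
countLess x []      = 0
countLess x (y ∷ w) with y Data.Nat.<? x
... | Relation.Nullary.yes _ = suc (countLess x w)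
... | Relation.Nullary.no  _ = countLess x w

-- standardization (for sequences of distinct naturals)
st : List ℕ → List ℕ
st w = map (λ x → suc (countLess x w)) w

subseqs : List ℕ → List (List ℕ)
subseqs []      = [] ∷ []
subseqs (x ∷ w) = map (x ∷_) (subseqs w) ++ subseqs w

open DecMem (≡-dec _≟_) using (_∈_; _∈?_)

Contains : List ℕ → List ℕ → Set
Contains p β = β ∈ map st (subseqs p)

contains? : (p β : List ℕ) → Dec (Contains p β)
contains? p β = β ∈? map st (subseqs p)

AvoidsAll : List (List ℕ) → List ℕ → Set
AvoidsAll B p = All (λ β → ¬ Contains p β) B

avoidsAll? : (B : List (List ℕ)) (p : List ℕ) → Dec (AvoidsAll B p)
avoidsAll? B p = all? (λ β → ¬? (contains? p β)) B

words : ℕ → ℕ → List (List ℕ)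
words m zero    = [] ∷ []
words m (suc n) = concatMap (λ x → map (x ∷_) (words m n)) (map suc (upTo m))

perms : ℕ → List (List ℕ)
perms n = filter isPerm? (words n n)

norm : List ℕ → ℕ
norm g = sum g

-- position of the i-th pattern entry: g₁ + ⋯ + gᵢ + i
pos : List ℕ → ℕ → ℕ
pos g i = sum (take i g) + i

Placed : List ℕ → List ℕ → List ℕ → Set
Placed π g p = All (λ i → at p (pos g i) ≡ at π i) (map suc (upTo (length π)))

placed? : (π g p : List ℕ) → Dec (Placed π g p)
placed? π g p = all? (λ i → ≡-decMaybe _≟_ (at p (pos g i)) (at π i)) (map suc (upTo (length π)))

Z : List (List ℕ) → List ℕ → List ℕ → List (List ℕ)
Z B π g = filter (λ p → avoidsAll? B p ×-dec placed? π g p) (perms (length π + norm g))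

cardZ : List (List ℕ) → List ℕ → List ℕ → ℕ
cardZ B π g = length (Z B π g)

-- delete the r-th entry (1-based)
deleteAt : ℕ → List ℕ → List ℕ
deleteAt _             []      = []
deleteAt zero          (x ∷ w) = x ∷ w
deleteAt (suc zero)    (x ∷ w) = w
deleteAt (suc (suc r)) (x ∷ w) = x ∷ deleteAt (suc r) w

dπ : ℕ → List ℕ → List ℕ
dπ r π = st (deleteAt r π)

dg : ℕ → List ℕ → List ℕ
dg _             []          = []
dg _             (x ∷ [])    = x ∷ []
dg zero          (x ∷ w)     = x ∷ w
dg (suc zero)    (x ∷ y ∷ w) = (x + y) ∷ w
dg (suc (suc r)) (x ∷ w)     = x ∷ dg (suc r) w

IsGap : List ℕ → List ℕ → Set
IsGap π g = length g ≡ suc (length π)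

InG : List (List ℕ) → List ℕ → List ℕ → Set
InG B π g = IsGap π g × ¬ (Z B π g ≡ [])

ESPlusReducible : List (List ℕ) → List ℕ → ℕ → Set
ESPlusReducible B π r =
  (g : List ℕ) → IsGap π g → ¬ (Z B π g ≡ []) → cardZ B π g ≡ cardZ B (dπ r π) (dg r g)

-- ‖B‖∞ = maximum length of a permutation in B (0 if B = ∅)
maxLen : List (List ℕ) → ℕ
maxLen B = foldr (λ β m → length β ⊔ m) 0 B

-- Every p ∈ Z(B;π;g) is π with its gaps filled by the values k+1, …, k+‖g‖, arranged in the pattern of
-- some h ∈ S_‖g‖. So |Z(B;π;g)| counts the h whose filling of π avoids B, and |Z(B;d_r π;d_r g)| counts
-- the h whose filling of d_r π (along d_r g) avoids B. The second filling is order isomorphic to the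
-- first one with π(r) deleted, hence counts can only grow, and they are equal unless some h is good for
-- d_r π but bad for π. Then some β ∈ B occurs in the filling of π, necessarily through π(r). Keeping
-- only the gap entries used by this occurrence yields a gap vector g′ with ‖g′‖ + 1 ≤ |β| ≤ ‖B‖∞ at which
-- the counts still differ; and g′ ∈ 𝒢(π), because restricting any element of Z(B;π;g) in the same way
-- gives an element of Z(B;π;g′).

module Submission where

open import Defs
open import Data.Bool using (Bool; true; false; f≤t; b≤b) renaming (_≤_ to _≤ᵇ_)
open import Data.Bool.Properties using () renaming (≤-maximum to ≤ᵇ-maximum)
open import Data.Empty using (⊥-elim)
open import Data.List using (List; []; _∷_; [_]; length; map; filter; concat; concatMap; upTo; take; drop; _++_; replicate; zipWith)
open import Data.List.Properties using (length-map; map-∘; map-id; map-++; length-++; ++-assoc; ++-identityʳ; ∷-injective; take++drop≡id; length-drop; take-map; drop-map; take-[]; drop-[]; length-upTo; map-injective; map-id-local)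
open import Data.List.Membership.Propositional using (_∈_; _∉_; find)
open import Data.List.Membership.Propositional.Properties using (∈-map⁺; ∈-map⁻; ∈-concatMap⁺; ∈-concatMap⁻; ∈-upTo⁺; ∈-upTo⁻; ∈-filter⁺; ∈-filter⁻; ∈-++⁺ˡ; ∈-++⁺ʳ; ∈-++⁻)
open import Data.List.Relation.Binary.Permutation.Propositional using (_↭_; prep; ↭-sym; ↭-trans; ↭-reflexive; ↭⇒↭ₛ; module PermutationReasoning)
import Data.List.Relation.Binary.Permutation.Propositional.Properties as ↭
import Data.List.Relation.Binary.Permutation.Setoid.Properties as ↭ₛ
open import Data.List.Relation.Binary.Pointwise as Pointwise using (Pointwise; []; _∷_)
open import Data.List.Relation.Binary.Sublist.Propositional using (_⊆_; []; _∷_; _∷ʳ_; ⊆-refl; ⊆-trans; minimum; lookup)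
open import Data.List.Relation.Binary.Sublist.Propositional.Properties using (++⁺; ++⁺ˡ; ++⁺ʳ; All-resp-⊆; map⁺)
open import Data.List.Relation.Unary.All using (All; []; _∷_; all?)
import Data.List.Relation.Unary.All as All
open import Data.List.Relation.Unary.All.Properties using (¬All⇒Any¬) renaming (map⁺ to All-map⁺)
open import Data.List.Relation.Unary.AllPairs using ([]; _∷_)
open import Data.List.Relation.Unary.Any using (here; there; satisfied)
import Data.List.Relation.Unary.Any as Any
open import Data.List.Relation.Unary.Unique.Propositional using (Unique)
import Data.List.Relation.Unary.Unique.Propositional.Properties as Unique
open import Data.Maybe using (just)
open import Data.Nat using (ℕ; zero; suc; _+_; _∸_; _≤_; _<_; z≤n; s≤s; _<?_; _≤?_)
open import Data.Nat.ListAction using (sum)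
open import Data.Nat.Properties using (+-commutativeSemigroup; _≟_; ≤-trans; ≤-antisym; <-trans; <-≤-trans; ≤-<-trans; <-irrefl; <-asym; <-cmp; <⇒≤; ≰⇒>; m≤n⇒m≤1+n; suc-injective; +-suc; +-assoc; +-comm; +-identityʳ; +-cancelˡ-≡; +-cancelˡ-<; +-monoʳ-≤; +-monoʳ-<; m≤m+n; m≤n+m; m<m+n; m+n∸m≡n; m+[n∸m]≡n; ∸-monoˡ-≤; m<n⇒0<n∸m; m≤m⊔n; module ≤-Reasoning; m≤n⊔m)
open import Data.List.Membership.DecPropositional _≟_ using (_∈?_)
open import Algebra.Properties.CommutativeSemigroup +-commutativeSemigroup using () renaming (interchange to +-interchange)
open import Data.Product using (∃; _×_; _,_; proj₁; proj₂; swap; uncurry)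
open import Data.Sum using (_⊎_; inj₁; inj₂)
open import Function.Base using (_∘′_)
open import Function.Bundles using (_⇔_; mk⇔)
open import Relation.Binary.Definitions using (tri<; tri≈; tri>)
open import Relation.Binary.PropositionalEquality using (_≡_; _≢_; refl; sym; trans; cong; cong₂; subst; subst₂; setoid; module ≡-Reasoning)
open import Relation.Nullary using (Dec; yes; no; ¬_; ¬?)
open import Relation.Nullary.Decidable using (_×-dec_; _→-dec_; decidable-stable)

-- Counting duplicate-free lists

∈⇒≢[] : ∀ {a} {A : Set a} {x : A} {xs} → x ∈ xs → xs ≢ []
∈⇒≢[] (here _)  ()
∈⇒≢[] (there _) ()

module _ {a} {A : Set a} where

  private
    remove : ∀ {x : A} {ys} → x ∈ ys → List A
    remove {ys = _ ∷ ys} (here _)  = ys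
    remove {ys = y ∷ ys} (there p) = y ∷ remove p

    length-remove : ∀ {x : A} {ys} (p : x ∈ ys) → length ys ≡ suc (length (remove p))
    length-remove (here _)  = refl
    length-remove (there p) = cong suc (length-remove p)

    ∈-remove : ∀ {x y : A} {ys} (p : x ∈ ys) → y ∈ ys → y ≢ x → y ∈ remove p
    ∈-remove (here refl) (here refl) y≢x = ⊥-elim (y≢x refl)
    ∈-remove (here _)    (there q)   _   = q
    ∈-remove (there p)   (here e)    _   = here e
    ∈-remove (there p)   (there q)   y≢x = there (∈-remove p q y≢x)

    ∉⇒All≢ : ∀ {x : A} {zs} → x ∉ zs → All (x ≢_) zs
    ∉⇒All≢ {zs = []}     _   = []
    ∉⇒All≢ {zs = z ∷ zs} x∉ = (λ e → x∉ (here e)) ∷ ∉⇒All≢ (λ q → x∉ (there q))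

    All≢⇒∉ : ∀ {x : A} {zs} → All (x ≢_) zs → x ∉ zs
    All≢⇒∉ (x≢z ∷ _)   (here refl) = x≢z refl
    All≢⇒∉ (_   ∷ x≢zs) (there q)   = All≢⇒∉ x≢zs q

  Unique⇒length-≤ : ∀ {xs ys : List A} → Unique xs → (∀ {y} → y ∈ xs → y ∈ ys) → length xs ≤ length ys
  Unique⇒length-≤ {[]}     _          _  = z≤n
  Unique⇒length-≤ {x ∷ xs} (x∉ ∷ uxs) xs⊆ys =
    subst (suc (length xs) ≤_) (sym (length-remove x∈ys))
      (s≤s (Unique⇒length-≤ uxs (λ y∈ → ∈-remove x∈ys (xs⊆ys (there y∈)) (λ { refl → All≢⇒∉ x∉ y∈ }))))
    where x∈ys = xs⊆ys (here refl)

  Unique⇒length-≡ : ∀ {xs ys : List A} → Unique xs → Unique ys →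
    (∀ {y} → y ∈ xs → y ∈ ys) → (∀ {y} → y ∈ ys → y ∈ xs) → length xs ≡ length ys
  Unique⇒length-≡ uxs uys xs⊆ys ys⊆xs = ≤-antisym (Unique⇒length-≤ uxs xs⊆ys) (Unique⇒length-≤ uys ys⊆xs)

  Unique-∉⇒length-< : ∀ {x} {xs ys : List A} → Unique xs → x ∉ xs → x ∈ ys →
    (∀ {y} → y ∈ xs → y ∈ ys) → length xs < length ys
  Unique-∉⇒length-< uxs x∉ x∈ xs⊆ys = Unique⇒length-≤ (∉⇒All≢ x∉ ∷ uxs) λ { (here refl) → x∈ ; (there y∈) → xs⊆ys y∈ }

  Unique-resp-⊇ : ∀ {xs ys : List A} → xs ⊆ ys → Unique ys → Unique xs
  Unique-resp-⊇ []          u          = u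
  Unique-resp-⊇ (_ ∷ʳ p)    (_ ∷ u)    = Unique-resp-⊇ p u
  Unique-resp-⊇ (refl ∷ p)  (y∉ ∷ u)   = All-resp-⊆ p y∉ ∷ Unique-resp-⊇ p u

  Unique-++⇒uniqueˡ : ∀ (xs : List A) {ys} → Unique (xs ++ ys) → Unique xs
  Unique-++⇒uniqueˡ xs {ys} = Unique-resp-⊇ (++⁺ʳ ys ⊆-refl)

  Unique-++⇒disjoint : ∀ (xs : List A) {ys v} → Unique (xs ++ ys) → v ∈ xs → v ∉ ys
  Unique-++⇒disjoint (x ∷ xs) (x∉ ∷ _) (here refl) v∈ys = All≢⇒∉ (All-resp-⊆ (++⁺ˡ xs ⊆-refl) x∉) v∈ys
  Unique-++⇒disjoint (x ∷ xs) (_ ∷ u)  (there v∈) v∈ys = Unique-++⇒disjoint xs u v∈ v∈ys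

  Unique-map⁺-on : ∀ {b} {B : Set b} (f : A → B) {xs} →
    (∀ {x y} → x ∈ xs → y ∈ xs → f x ≡ f y → x ≡ y) → Unique xs → Unique (map f xs)
  Unique-map⁺-on f {[]}     _   _          = []
  Unique-map⁺-on f {x ∷ xs} inj (x∉ ∷ uxs) =
    All-map⁺ (All.tabulate (λ y∈ fx≡fy → All≢⇒∉ x∉ (subst (_∈ xs) (sym (inj (here refl) (there y∈) fx≡fy)) y∈)))
      ∷ Unique-map⁺-on f (λ p q → inj (there p) (there q)) uxs

  length-filter-mono : ∀ {p} {P Q : A → Set p} (P? : ∀ x → Dec (P x)) (Q? : ∀ x → Dec (Q x)) → ∀ xs →
    (∀ {x} → x ∈ xs → P x → Q x) → length (filter P? xs) ≤ length (filter Q? xs)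
  length-filter-mono P? Q? []       _   = z≤n
  length-filter-mono P? Q? (x ∷ xs) P⇒Q with P? x | Q? x
  ... | yes _  | yes _  = s≤s (length-filter-mono P? Q? xs (P⇒Q ∘′ there))
  ... | yes px | no ¬qx = ⊥-elim (¬qx (P⇒Q (here refl) px))
  ... | no _   | yes _  = m≤n⇒m≤1+n (length-filter-mono P? Q? xs (P⇒Q ∘′ there))
  ... | no _   | no _   = length-filter-mono P? Q? xs (P⇒Q ∘′ there)

  length-filter-< : ∀ {p} {P Q : A → Set p} (P? : ∀ x → Dec (P x)) (Q? : ∀ x → Dec (Q x)) → ∀ xs →
    (∀ {x} → x ∈ xs → P x → Q x) → ∀ {z} → z ∈ xs → Q z → ¬ P z →
    length (filter P? xs) < length (filter Q? xs)
  length-filter-< P? Q? (x ∷ xs) P⇒Q (here refl) qz ¬pz with P? x | Q? x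
  ... | yes px | _      = ⊥-elim (¬pz px)
  ... | no _   | yes _  = s≤s (length-filter-mono P? Q? xs (P⇒Q ∘′ there))
  ... | no _   | no ¬qz = ⊥-elim (¬qz qz)
  length-filter-< P? Q? (x ∷ xs) P⇒Q (there z∈) qz ¬pz with P? x | Q? x
  ... | yes _  | yes _  = s≤s (length-filter-< P? Q? xs (P⇒Q ∘′ there) z∈ qz ¬pz)
  ... | yes px | no ¬qx = ⊥-elim (¬qx (P⇒Q (here refl) px))
  ... | no _   | yes _  = m≤n⇒m≤1+n (length-filter-< P? Q? xs (P⇒Q ∘′ there) z∈ qz ¬pz)
  ... | no _   | no _   = length-filter-< P? Q? xs (P⇒Q ∘′ there) z∈ qz ¬pz

  length-filter-cong : ∀ {p} {P Q : A → Set p} (P? : ∀ x → Dec (P x)) (Q? : ∀ x → Dec (Q x)) → ∀ xs →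
    (∀ {x} → x ∈ xs → P x → Q x) → (∀ {x} → x ∈ xs → Q x → P x) →
    length (filter P? xs) ≡ length (filter Q? xs)
  length-filter-cong P? Q? xs P⇒Q Q⇒P = ≤-antisym (length-filter-mono P? Q? xs P⇒Q) (length-filter-mono Q? P? xs Q⇒P)

-- Enumerating permutations

∈-words⁻ : ∀ m n {w} → w ∈ words m n → length w ≡ n
∈-words⁻ m zero    (here refl) = refl
∈-words⁻ m (suc n) w∈ with satisfied (∈-concatMap⁻ (λ x → map (x ∷_) (words m n)) {xs = map suc (upTo m)} w∈)
... | x , w∈x∷words with ∈-map⁻ (x ∷_) w∈x∷words
... | w′ , w′∈ , refl = cong suc (∈-words⁻ m n w′∈)

∈-words⁺ : ∀ m n w → length w ≡ n → All (λ x → 1 ≤ x × x ≤ m) w → w ∈ words m n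
∈-words⁺ m zero    []          refl []                    = here refl
∈-words⁺ m (suc n) (suc x ∷ w) refl ((_ , s≤s x<m) ∷ ws) =
  ∈-concatMap⁺ (λ y → map (y ∷_) (words m n)) {xs = map suc (upTo m)}
    (Any.map (λ { refl → ∈-map⁺ (suc x ∷_) (∈-words⁺ m n w refl ws) }) (∈-map⁺ suc (∈-upTo⁺ (s≤s x<m))))

words-unique : ∀ m n → Unique (words m n)
words-unique m zero    = [] ∷ []
words-unique m (suc n) = prefixes-unique (map suc (upTo m)) (Unique.map⁺ suc-injective (Unique.upTo⁺ m))
  where
  W = words m n
  x∷W∉ : ∀ {x ys} → All (x ≢_) ys → ∀ {v} → x ∷ v ∉ concatMap (λ y → map (y ∷_) W) ys
  x∷W∉ {ys = y ∷ ys} (x≢y ∷ x≢ys) v∈ with ∈-++⁻ (map (y ∷_) W) v∈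
  ... | inj₁ v∈y∷W with ∈-map⁻ (y ∷_) v∈y∷W
  ...   | _ , _ , e = x≢y (proj₁ (∷-injective e))
  x∷W∉ {ys = y ∷ ys} (x≢y ∷ x≢ys) v∈ | inj₂ v∈rest = x∷W∉ x≢ys v∈rest
  prefixes-unique : ∀ xs → Unique xs → Unique (concatMap (λ x → map (x ∷_) W) xs)
  prefixes-unique []       _          = []
  prefixes-unique (x ∷ xs) (x∉ ∷ uxs) =
    Unique.++⁺ (Unique.map⁺ (proj₂ ∘′ ∷-injective) (words-unique m n)) (prefixes-unique xs uxs) disjoint
    where
    disjoint : ∀ {v} → ¬ (v ∈ map (x ∷_) W × v ∈ concatMap (λ y → map (y ∷_) W) xs)
    disjoint (v∈x∷W , v∈rest) with ∈-map⁻ (x ∷_) v∈x∷W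
    ... | _ , _ , refl = x∷W∉ x∉ v∈rest

perms-unique : ∀ n → Unique (perms n)
perms-unique n = Unique.filter⁺ isPerm? (words-unique n n)

∈-perms⁺ : ∀ {p} → IsPerm p → p ∈ perms (length p)
∈-perms⁺ {p} isPerm = ∈-filter⁺ isPerm? (∈-words⁺ _ _ p refl (proj₂ isPerm)) isPerm

∈-perms⁻ : ∀ {n p} → p ∈ perms n → IsPerm p × length p ≡ n
∈-perms⁻ {n} p∈ with ∈-filter⁻ isPerm? {xs = words n n} p∈
... | p∈words , isPerm = isPerm , ∈-words⁻ n n p∈words

IsPerm⇒∈ : ∀ {τ v} → IsPerm τ → 1 ≤ v → v ≤ length τ → v ∈ τ
IsPerm⇒∈ {τ} {v} (uτ , bτ) 1≤v v≤k with v ∈? τ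
... | yes v∈ = v∈
... | no  v∉ = ⊥-elim (<-irrefl (sym (length-range (length τ)))
                 (Unique-∉⇒length-< uτ v∉ (∈-range 1≤v v≤k) (λ x∈ → uncurry ∈-range (All.lookup bτ x∈))))
  where
  ∈-range : ∀ {x} → 1 ≤ x → x ≤ length τ → x ∈ map suc (upTo (length τ))
  ∈-range {suc x} _ x≤k = ∈-map⁺ suc (∈-upTo⁺ x≤k)
  length-range : ∀ n → length (map suc (upTo n)) ≡ n
  length-range n = trans (length-map suc (upTo n)) (length-upTo n)

-- Standardization and order isomorphism

SameOrder : ℕ × ℕ → ℕ × ℕ → Set
SameOrder (a , b) (c , d) = (c < a → d < b) × (d < b → c < a)

OrderPreserving : List (ℕ × ℕ) → Set
OrderPreserving zs = ∀ {u v} → u ∈ zs → v ∈ zs → SameOrder u v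

-- w ≅ v is witnessed by the list of pairs (w(i), v(i)).
infix 4 _≅_
_≅_ : List ℕ → List ℕ → Set
w ≅ v = ∃ λ zs → OrderPreserving zs × map proj₁ zs ≡ w × map proj₂ zs ≡ v

OrderPreserving-resp-⊇ : ∀ {ys zs} → ys ⊆ zs → OrderPreserving zs → OrderPreserving ys
OrderPreserving-resp-⊇ ys⊆zs op u∈ v∈ = op (lookup ys⊆zs u∈) (lookup ys⊆zs v∈)

≅-refl : ∀ {w} → w ≅ w
≅-refl {w} = map (λ c → c , c) w , op , trans (sym (map-∘ w)) (map-id w) , trans (sym (map-∘ w)) (map-id w)
  where
  op : OrderPreserving (map (λ c → c , c) w)
  op u∈ v∈ with ∈-map⁻ (λ c → c , c) u∈ | ∈-map⁻ (λ c → c , c) v∈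
  ... | _ , _ , refl | _ , _ , refl = (λ c<a → c<a) , (λ c<a → c<a)

≅-sym : ∀ {w v} → w ≅ v → v ≅ w
≅-sym (zs , op , refl , refl) = map swap zs , op′ , sym (map-∘ zs) , sym (map-∘ zs)
  where
  op′ : OrderPreserving (map swap zs)
  op′ u∈ v∈ with ∈-map⁻ swap u∈ | ∈-map⁻ swap v∈
  ... | _ , p , refl | _ , q , refl = swap (op p q)

map-+-≅ : ∀ i j {w v} → w ≅ v → map (i +_) w ≅ map (j +_) v
map-+-≅ i j (zs , op , refl , refl) = map shift zs , op′ , trans (sym (map-∘ zs)) (map-∘ zs) , trans (sym (map-∘ zs)) (map-∘ zs)
  where
  shift : ℕ × ℕ → ℕ × ℕ
  shift (a , b) = i + a , j + b
  op′ : OrderPreserving (map shift zs)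
  op′ u∈ v∈ with ∈-map⁻ shift u∈ | ∈-map⁻ shift v∈
  ... | (a , b) , p , refl | (c , d) , q , refl with op p q
  ... | c<a⇒d<b , d<b⇒c<a =
    (λ lt → +-monoʳ-< j (c<a⇒d<b (+-cancelˡ-< i c a lt))) , (λ lt → +-monoʳ-< i (d<b⇒c<a (+-cancelˡ-< j d b lt)))

countLess-resp-SameOrder : ∀ ys a b → (∀ {u} → u ∈ ys → SameOrder (a , b) u) →
  countLess a (map proj₁ ys) ≡ countLess b (map proj₂ ys)
countLess-resp-SameOrder []             a b _    = refl
countLess-resp-SameOrder ((c , d) ∷ ys) a b same with c <? a | d <? b | same (here refl)
... | yes _   | yes _   | _           = cong suc (countLess-resp-SameOrder ys a b (same ∘′ there))
... | yes c<a | no d≮b  | (⇒d<b , _) = ⊥-elim (d≮b (⇒d<b c<a))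
... | no c≮a  | yes d<b | (_ , ⇒c<a) = ⊥-elim (c≮a (⇒c<a d<b))
... | no _    | no _    | _           = countLess-resp-SameOrder ys a b (same ∘′ there)

st-resp-≅ : ∀ {w v} → w ≅ v → st w ≡ st v
st-resp-≅ (zs , op , refl , refl) = ranks-agree zs (λ u∈ → u∈)
  where
  ranks-agree : ∀ ys → (∀ {u} → u ∈ ys → u ∈ zs) →
    map (λ x → suc (countLess x (map proj₁ zs))) (map proj₁ ys) ≡ map (λ x → suc (countLess x (map proj₂ zs))) (map proj₂ ys)
  ranks-agree []             _     = refl
  ranks-agree ((a , b) ∷ ys) ys⊆zs =
    cong₂ _∷_ (cong suc (countLess-resp-SameOrder zs a b (op (ys⊆zs (here refl))))) (ranks-agree ys (ys⊆zs ∘′ there))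

countLess-mono : ∀ {a b} w → a ≤ b → countLess a w ≤ countLess b w
countLess-mono []      _   = z≤n
countLess-mono {a} {b} (y ∷ w) a≤b with y <? a | y <? b
... | yes _   | yes _  = s≤s (countLess-mono w a≤b)
... | yes y<a | no y≮b = ⊥-elim (y≮b (<-≤-trans y<a a≤b))
... | no _    | yes _  = m≤n⇒m≤1+n (countLess-mono w a≤b)
... | no _    | no _   = countLess-mono w a≤b

countLess-<-mono : ∀ {c a} w → c < a → c ∈ w → countLess c w < countLess a w
countLess-<-mono {c} {a} (y ∷ w) c<a (here refl) with y <? c | y <? a
... | yes y<y | _      = ⊥-elim (<-irrefl refl y<y)
... | no _    | yes _  = s≤s (countLess-mono w (<⇒≤ c<a))
... | no _    | no y≮a = ⊥-elim (y≮a c<a)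
countLess-<-mono {c} {a} (y ∷ w) c<a (there c∈) with y <? c | y <? a
... | yes _   | yes _  = s≤s (countLess-<-mono w c<a c∈)
... | yes y<c | no y≮a = ⊥-elim (y≮a (<-trans y<c c<a))
... | no _    | yes _  = m≤n⇒m≤1+n (countLess-<-mono w c<a c∈)
... | no _    | no _   = countLess-<-mono w c<a c∈

countLess-≤-length : ∀ a w → countLess a w ≤ length w
countLess-≤-length a []      = z≤n
countLess-≤-length a (y ∷ w) with y <? a
... | yes _ = s≤s (countLess-≤-length a w)
... | no _  = m≤n⇒m≤1+n (countLess-≤-length a w)

countLess-<-length : ∀ {a} w → a ∈ w → countLess a w < length w
countLess-<-length {a} (y ∷ w) (here refl) with y <? a
... | yes y<y = ⊥-elim (<-irrefl refl y<y)
... | no _    = s≤s (countLess-≤-length a w)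
countLess-<-length {a} (y ∷ w) (there a∈) with y <? a
... | yes _ = s≤s (countLess-<-length w a∈)
... | no _  = m≤n⇒m≤1+n (countLess-<-length w a∈)

countLess-injective : ∀ {w x y} → x ∈ w → y ∈ w → countLess x w ≡ countLess y w → x ≡ y
countLess-injective {w} {x} {y} x∈ y∈ e with <-cmp x y
... | tri< x<y _ _ = ⊥-elim (<-irrefl e (countLess-<-mono w x<y x∈))
... | tri≈ _ x≡y _ = x≡y
... | tri> _ _ y<x = ⊥-elim (<-irrefl (sym e) (countLess-<-mono w y<x y∈))

st-≅ : ∀ w → st w ≅ w
st-≅ w = map rank w , op , sym (map-∘ w) , trans (sym (map-∘ w)) (map-id w)
  where
  rank : ℕ → ℕ × ℕ
  rank a = suc (countLess a w) , a
  op : OrderPreserving (map rank w)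
  op u∈ v∈ with ∈-map⁻ rank u∈ | ∈-map⁻ rank v∈
  ... | a , a∈ , refl | c , c∈ , refl = c<a , (λ c<a → s≤s (countLess-<-mono w c<a c∈))
    where
    c<a : suc (countLess c w) < suc (countLess a w) → c < a
    c<a (s≤s lt) with <-cmp c a
    ... | tri< c<a _ _ = c<a
    ... | tri≈ _ refl _ = ⊥-elim (<-irrefl refl lt)
    ... | tri> _ _ a<c = ⊥-elim (<-asym lt (countLess-<-mono w a<c a∈))

st-isPerm : ∀ {w} → Unique w → IsPerm (st w)
st-isPerm {w} uw =
  Unique-map⁺-on _ (λ x∈ y∈ e → countLess-injective x∈ y∈ (suc-injective e)) uw ,
  All-map⁺ (All.tabulate λ {a} a∈ → s≤s z≤n , subst (suc (countLess a w) ≤_) (sym (length-map _ w)) (countLess-<-length w a∈))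

st-positive : ∀ w → All (1 ≤_) (st w)
st-positive w = All-map⁺ (All.tabulate λ _ → s≤s z≤n)

-- Pattern containment

⊆⇒∈-subseqs : ∀ {s w : List ℕ} → s ⊆ w → s ∈ subseqs w
⊆⇒∈-subseqs []                      = here refl
⊆⇒∈-subseqs {w = x ∷ w} (_ ∷ʳ s⊆w)  = ∈-++⁺ʳ (map (x ∷_) (subseqs w)) (⊆⇒∈-subseqs s⊆w)
⊆⇒∈-subseqs {w = x ∷ w} (refl ∷ s⊆w) = ∈-++⁺ˡ (∈-map⁺ (x ∷_) (⊆⇒∈-subseqs s⊆w))

∈-subseqs⇒⊆ : ∀ {s : List ℕ} w → s ∈ subseqs w → s ⊆ w
∈-subseqs⇒⊆ []      (here refl) = []
∈-subseqs⇒⊆ (x ∷ w) s∈ with ∈-++⁻ (map (x ∷_) (subseqs w)) s∈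
... | inj₂ s∈w = x ∷ʳ ∈-subseqs⇒⊆ w s∈w
... | inj₁ s∈x∷w with ∈-map⁻ (x ∷_) s∈x∷w
...   | _ , s∈w , refl = refl ∷ ∈-subseqs⇒⊆ w s∈w

contains⁻ : ∀ {w β} → Contains w β → ∃ λ s → s ⊆ w × st s ≡ β
contains⁻ {w} c with ∈-map⁻ st c
... | s , s∈ , e = s , ∈-subseqs⇒⊆ w s∈ , sym e

contains⁺ : ∀ {w β s} → s ⊆ w → st s ≡ β → Contains w β
contains⁺ s⊆w refl = ∈-map⁺ st (⊆⇒∈-subseqs s⊆w)

Contains-mono : ∀ {w w′ β} → w ⊆ w′ → Contains w β → Contains w′ β
Contains-mono w⊆w′ c with contains⁻ c
... | s , s⊆w , e = contains⁺ (⊆-trans s⊆w w⊆w′) e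

⊆-map⁻ : ∀ {a b} {A : Set a} {B : Set b} (f : A → B) {s} zs → s ⊆ map f zs → ∃ λ ys → ys ⊆ zs × map f ys ≡ s
⊆-map⁻ f []       []           = [] , [] , refl
⊆-map⁻ f (z ∷ zs) (_ ∷ʳ s⊆)   with ⊆-map⁻ f zs s⊆
... | ys , ys⊆ , refl = ys , z ∷ʳ ys⊆ , refl
⊆-map⁻ f (z ∷ zs) (refl ∷ s⊆) with ⊆-map⁻ f zs s⊆
... | ys , ys⊆ , refl = z ∷ ys , refl ∷ ys⊆ , refl

Contains-resp-≅ : ∀ {w v β} → w ≅ v → Contains w β → Contains v β
Contains-resp-≅ (zs , op , refl , refl) c with contains⁻ c
... | s , s⊆ , refl with ⊆-map⁻ proj₁ zs s⊆
... | ys , ys⊆zs , refl = contains⁺ (map⁺ proj₂ ys⊆zs) (sym (st-resp-≅ (ys , OrderPreserving-resp-⊇ ys⊆zs op , refl , refl)))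

AvoidsAll-resp-⊇ : ∀ {B w w′} → w′ ⊆ w → AvoidsAll B w → AvoidsAll B w′
AvoidsAll-resp-⊇ w′⊆w = All.map (λ ¬c c → ¬c (Contains-mono w′⊆w c))

AvoidsAll-resp-≅ : ∀ {B w v} → w ≅ v → AvoidsAll B v → AvoidsAll B w
AvoidsAll-resp-≅ w≅v = All.map (λ ¬c c → ¬c (Contains-resp-≅ w≅v c))

-- Gaps as blocks

module _ {a} {A : Set a} where

  interleave : List (List A) → List A → List A
  interleave []       _        = []
  interleave (G ∷ Gs) []       = G
  interleave (G ∷ Gs) (x ∷ xs) = G ++ x ∷ interleave Gs xs

  cut : List ℕ → List A → List (List A)
  cut []      _ = []
  cut (n ∷ g) w = take n w ∷ cut g (drop n w)

  mergeAt : ℕ → List (List A) → List (List A)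
  mergeAt _             []          = []
  mergeAt _             (G ∷ [])    = G ∷ []
  mergeAt zero          (G ∷ H ∷ Gs) = G ∷ H ∷ Gs
  mergeAt (suc zero)    (G ∷ H ∷ Gs) = (G ++ H) ∷ Gs
  mergeAt (suc (suc r)) (G ∷ H ∷ Gs) = G ∷ mergeAt (suc r) (H ∷ Gs)

  length-take-≤ : ∀ n (w : List A) → n ≤ length w → length (take n w) ≡ n
  length-take-≤ zero    w       _         = refl
  length-take-≤ (suc n) (x ∷ w) (s≤s n≤) = cong suc (length-take-≤ n w n≤)

  take-length-++ : ∀ (X Y : List A) → take (length X) (X ++ Y) ≡ X
  take-length-++ []      Y = refl
  take-length-++ (x ∷ X) Y = cong (x ∷_) (take-length-++ X Y)

  drop-length-++ : ∀ (X Y : List A) → drop (length X) (X ++ Y) ≡ Y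
  drop-length-++ []      Y = refl
  drop-length-++ (x ∷ X) Y = drop-length-++ X Y

  take-+ : ∀ m n (w : List A) → take (m + n) w ≡ take m w ++ take n (drop m w)
  take-+ zero    n w       = refl
  take-+ (suc m) n []      = sym (take-[] n)
  take-+ (suc m) n (x ∷ w) = cong (x ∷_) (take-+ m n w)

  drop-+ : ∀ m n (w : List A) → drop (m + n) w ≡ drop n (drop m w)
  drop-+ zero    n w       = refl
  drop-+ (suc m) n []      = sym (drop-[] n)
  drop-+ (suc m) n (x ∷ w) = drop-+ m n w

  length-drop-suc : ∀ (w : List A) k a s → length w ≡ suc k + (a + s) → length (drop (suc a) w) ≡ k + s
  length-drop-suc w k a s lw = begin
    length (drop (suc a) w)    ≡⟨ length-drop (suc a) w ⟩
    length w ∸ suc a           ≡⟨ cong (_∸ suc a) lw ⟩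
    suc (k + (a + s)) ∸ suc a  ≡⟨ cong (_∸ a) (+-comm k (a + s)) ⟩
    a + s + k ∸ a              ≡⟨ cong (_∸ a) (+-assoc a s k) ⟩
    a + (s + k) ∸ a            ≡⟨ m+n∸m≡n a (s + k) ⟩
    s + k                      ≡⟨ +-comm s k ⟩
    k + s                      ∎
    where open ≡-Reasoning

  <-length-suc : ∀ (w : List A) k a s → length w ≡ suc k + (a + s) → a < length w
  <-length-suc w k a s lw = subst (a <_) (sym lw) (s≤s (≤-trans (m≤m+n a s) (m≤n+m (a + s) k)))

  private
    length-drop-sum : ∀ n g (w : List A) → length w ≡ n + sum g → length (drop n w) ≡ sum g
    length-drop-sum n g w lw = trans (length-drop n w) (trans (cong (_∸ n) lw) (m+n∸m≡n n (sum g)))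

  map-length-cut : ∀ g (w : List A) → length w ≡ sum g → map length (cut g w) ≡ g
  map-length-cut []      w lw = refl
  map-length-cut (n ∷ g) w lw =
    cong₂ _∷_ (length-take-≤ n w (subst (n ≤_) (sym lw) (m≤m+n n (sum g)))) (map-length-cut g (drop n w) (length-drop-sum n g w lw))

  length-cut : ∀ g (w : List A) → length (cut g w) ≡ length g
  length-cut []      w = refl
  length-cut (n ∷ g) w = cong suc (length-cut g (drop n w))

  concat-cut : ∀ g (w : List A) → length w ≡ sum g → concat (cut g w) ≡ w
  concat-cut []      [] lw = refl
  concat-cut (n ∷ g) w  lw = trans (cong (take n w ++_) (concat-cut g (drop n w) (length-drop-sum n g w lw))) (take++drop≡id n w)

  cut-concat : ∀ (Gs : List (List A)) → cut (map length Gs) (concat Gs) ≡ Gs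
  cut-concat []       = refl
  cut-concat (G ∷ Gs) =
    cong₂ _∷_ (take-length-++ G (concat Gs)) (trans (cong (cut (map length Gs)) (drop-length-++ G (concat Gs))) (cut-concat Gs))

  cut-dg : ∀ r g (w : List A) → cut (dg r g) w ≡ mergeAt r (cut g w)
  cut-dg r             []          w = refl
  cut-dg r             (n ∷ [])    w = refl
  cut-dg zero          (n ∷ m ∷ g) w = refl
  cut-dg (suc zero)    (n ∷ m ∷ g) w = cong₂ _∷_ (take-+ n m w) (cong (cut g) (drop-+ n m w))
  cut-dg (suc (suc r)) (n ∷ m ∷ g) w = cong (take n w ∷_) (cut-dg (suc r) (m ∷ g) (drop n w))

  map-mergeAt : ∀ (f : List A → ℕ) → (∀ X Y → f (X ++ Y) ≡ f X + f Y) → ∀ r Gs → map f (mergeAt r Gs) ≡ dg r (map f Gs)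
  map-mergeAt f f-++ r             []          = refl
  map-mergeAt f f-++ r             (G ∷ [])    = refl
  map-mergeAt f f-++ zero          (G ∷ H ∷ Gs) = refl
  map-mergeAt f f-++ (suc zero)    (G ∷ H ∷ Gs) = cong (_∷ map f Gs) (f-++ G H)
  map-mergeAt f f-++ (suc (suc r)) (G ∷ H ∷ Gs) = cong (f G ∷_) (map-mergeAt f f-++ (suc r) (H ∷ Gs))

  concat-mergeAt : ∀ r (Gs : List (List A)) → concat (mergeAt r Gs) ≡ concat Gs
  concat-mergeAt r             []          = refl
  concat-mergeAt r             (G ∷ [])    = refl
  concat-mergeAt zero          (G ∷ H ∷ Gs) = refl
  concat-mergeAt (suc zero)    (G ∷ H ∷ Gs) = ++-assoc G H (concat Gs)
  concat-mergeAt (suc (suc r)) (G ∷ H ∷ Gs) = cong (G ++_) (concat-mergeAt (suc r) (H ∷ Gs))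

  length-concat : ∀ (Gs : List (List A)) → length (concat Gs) ≡ sum (map length Gs)
  length-concat []       = refl
  length-concat (G ∷ Gs) = trans (length-++ G) (cong (length G +_) (length-concat Gs))

  ∈-interleave⁻ : ∀ Gs xs {u} → u ∈ interleave Gs xs → u ∈ concat Gs ⊎ u ∈ xs
  ∈-interleave⁻ (G ∷ Gs) []       u∈ = inj₁ (∈-++⁺ˡ u∈)
  ∈-interleave⁻ (G ∷ Gs) (x ∷ xs) u∈ with ∈-++⁻ G u∈
  ... | inj₁ u∈G         = inj₁ (∈-++⁺ˡ u∈G)
  ... | inj₂ (here u≡x)  = inj₂ (here u≡x)
  ... | inj₂ (there u∈′) with ∈-interleave⁻ Gs xs u∈′
  ...   | inj₁ u∈Gs = inj₁ (∈-++⁺ʳ G u∈Gs)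
  ...   | inj₂ u∈xs = inj₂ (there u∈xs)

  ∈-concat-cut⁻ : ∀ g (w : List A) {u} → u ∈ concat (cut g w) → u ∈ w
  ∈-concat-cut⁻ (n ∷ g) w u∈ with ∈-++⁻ (take n w) u∈
  ... | inj₁ u∈take = subst (_ ∈_) (take++drop≡id n w) (∈-++⁺ˡ u∈take)
  ... | inj₂ u∈rest = subst (_ ∈_) (take++drop≡id n w) (∈-++⁺ʳ (take n w) (∈-concat-cut⁻ g (drop n w) u∈rest))

  ++-injective-length : ∀ {G H Y Z : List A} → length G ≡ length H → G ++ Y ≡ H ++ Z → G ≡ H × Y ≡ Z
  ++-injective-length {[]}    {[]}    _   e = refl , e
  ++-injective-length {x ∷ G} {y ∷ H} |G| e with ∷-injective e
  ... | refl , e′ with ++-injective-length {G} {H} (suc-injective |G|) e′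
  ...   | refl , Y≡Z = refl , Y≡Z

  interleave-injective : ∀ (Gs Hs : List (List A)) xs → length Gs ≡ suc (length xs) → map length Gs ≡ map length Hs →
    interleave Gs xs ≡ interleave Hs xs → Gs ≡ Hs
  interleave-injective (G ∷ [])      (H ∷ [])      []       _  _    e = cong (_∷ []) e
  interleave-injective (G ∷ G′ ∷ Gs) (H ∷ H′ ∷ Hs) (x ∷ xs) lG lens e with ∷-injective lens
  ... | |G|≡|H| , lens′ with ++-injective-length {G} {H} |G|≡|H| e
  ...   | refl , e′ =
    cong (G ∷_) (interleave-injective (G′ ∷ Gs) (H′ ∷ Hs) xs (suc-injective lG) lens′ (proj₂ (∷-injective e′)))

  take-∷-drop : ∀ n (w : List A) → n < length w → ∃ λ x → w ≡ take n w ++ x ∷ drop (suc n) w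
  take-∷-drop zero    (x ∷ w) _         = x , refl
  take-∷-drop (suc n) (y ∷ w) (s≤s n<) with take-∷-drop n w n<
  ... | x , e = x , cong (y ∷_) e

  split-interleave : ∀ g k (w : List A) → length g ≡ suc k → length w ≡ k + sum g →
    ∃ λ Ws → ∃ λ xs → map length Ws ≡ g × length xs ≡ k × w ≡ interleave Ws xs
  split-interleave (g₁ ∷ []) zero    w _  lw = w ∷ [] , [] , cong (_∷ []) (trans lw (+-identityʳ g₁)) , refl , refl
  split-interleave (g₁ ∷ g)  (suc k) w lg lw with take-∷-drop g₁ w (<-length-suc w k g₁ (sum g) lw)
  ... | x , w≡ with split-interleave g k (drop (suc g₁) w) (suc-injective lg) (length-drop-suc w k g₁ (sum g) lw)
  ...   | Ws , xs , lens , |xs| , w′≡ = take g₁ w ∷ Ws , x ∷ xs ,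
    cong₂ _∷_ (length-take-≤ g₁ w (<⇒≤ (<-length-suc w k g₁ (sum g) lw))) lens , cong suc |xs| ,
    trans w≡ (cong (λ t → take g₁ w ++ x ∷ t) w′≡)

module _ {a b} {A : Set a} {B : Set b} (f : A → B) where

  map-interleave : ∀ Gs xs → map f (interleave Gs xs) ≡ interleave (map (map f) Gs) (map f xs)
  map-interleave []       xs       = refl
  map-interleave (G ∷ Gs) []       = refl
  map-interleave (G ∷ Gs) (x ∷ xs) = trans (map-++ f G _) (cong (λ t → map f G ++ f x ∷ t) (map-interleave Gs xs))

  map-cut : ∀ g w → map (map f) (cut g w) ≡ cut g (map f w)
  map-cut []      w = refl
  map-cut (n ∷ g) w = sym (cong₂ _∷_ (take-map n w) (trans (cong (cut g) (drop-map n w)) (sym (map-cut g (drop n w)))))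

  map-interleave-cut : ∀ g w xs → map f (interleave (cut g w) xs) ≡ interleave (cut g (map f w)) (map f xs)
  map-interleave-cut g w xs = trans (map-interleave (cut g w) xs) (cong (λ Gs → interleave Gs (map f xs)) (map-cut g w))

interleave-cut-≅ : ∀ g {u u′ x x′} → u ≅ u′ → x ≅ x′ →
  (∀ {a c} → a ∈ u → c ∈ x → c < a) → (∀ {a c} → a ∈ u′ → c ∈ x′ → c < a) →
  interleave (cut g u) x ≅ interleave (cut g u′) x′
interleave-cut-≅ g (ws , opw , refl , refl) (ps , opp , refl , refl) x<u x′<u′ =
  interleave (cut g ws) ps , op , map-interleave-cut proj₁ g ws ps , map-interleave-cut proj₂ g ws ps
  where
  below : ∀ {a b c d} → (a , b) ∈ ws → (c , d) ∈ ps → c < a × d < b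
  below ab∈ cd∈ = x<u (∈-map⁺ proj₁ ab∈) (∈-map⁺ proj₁ cd∈) , x′<u′ (∈-map⁺ proj₂ ab∈) (∈-map⁺ proj₂ cd∈)
  op : OrderPreserving (interleave (cut g ws) ps)
  op u∈ v∈ with ∈-interleave⁻ (cut g ws) ps u∈ | ∈-interleave⁻ (cut g ws) ps v∈
  ... | inj₁ p | inj₁ q = opw (∈-concat-cut⁻ g ws p) (∈-concat-cut⁻ g ws q)
  ... | inj₂ p | inj₂ q = opp p q
  ... | inj₁ p | inj₂ q = let c<a , d<b = below (∈-concat-cut⁻ g ws p) q in (λ _ → d<b) , (λ _ → c<a)
  ... | inj₂ p | inj₁ q = let c<a , d<b = below (∈-concat-cut⁻ g ws q) p in
    (λ a<c → ⊥-elim (<-asym a<c c<a)) , (λ b<d → ⊥-elim (<-asym b<d d<b))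

-- Placement of the pattern entries

PlacedAt : List ℕ → List ℕ → List ℕ → Set
PlacedAt π g p = ∀ i → 1 ≤ i → i ≤ length π → at p (pos g i) ≡ at π i

Placed⇒PlacedAt : ∀ {π g p} → Placed π g p → PlacedAt π g p
Placed⇒PlacedAt placed (suc j) _ i≤k = All.lookup placed (∈-map⁺ suc (∈-upTo⁺ i≤k))

PlacedAt⇒Placed : ∀ {π g p} → PlacedAt π g p → Placed π g p
PlacedAt⇒Placed {π} placedAt = All.tabulate λ i∈ → at-position i∈
  where
  at-position : ∀ {i} → i ∈ map suc (upTo (length π)) → _
  at-position i∈ with ∈-map⁻ suc i∈
  ... | j , j∈ , refl = placedAt (suc j) (s≤s z≤n) (∈-upTo⁻ j∈)

pos-one : ∀ g₁ g → pos (g₁ ∷ g) 1 ≡ suc g₁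
pos-one g₁ g = trans (+-comm (g₁ + 0) 1) (cong suc (+-identityʳ g₁))

pos-∷ : ∀ g₁ g j → pos (g₁ ∷ g) (suc (suc j)) ≡ suc g₁ + pos g (suc j)
pos-∷ g₁ g j = trans (+-assoc g₁ S (suc (suc j))) (trans (cong (g₁ +_) (+-suc S (suc j))) (+-suc g₁ (S + suc j)))
  where S = sum (take (suc j) g)

pos-positive : ∀ g j → 1 ≤ pos g (suc j)
pos-positive g j = ≤-trans (s≤s z≤n) (m≤n+m (suc j) (sum (take (suc j) g)))

at-drop : ∀ n p {i} → 1 ≤ i → at p (n + i) ≡ at (drop n p) i
at-drop zero    p       _ = refl
at-drop (suc n) []      _ = refl
at-drop (suc n) (x ∷ p) {suc i} _ =
  trans (cong (λ t → at (x ∷ p) (suc t)) (+-suc n i)) (trans (cong (at p) (sym (+-suc n i))) (at-drop n p (s≤s z≤n)))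

PlacedAt-∷⁻ : ∀ {x π g₁ g p} → PlacedAt (x ∷ π) (g₁ ∷ g) p → at p (suc g₁) ≡ just x × PlacedAt π g (drop (suc g₁) p)
PlacedAt-∷⁻ {x} {π} {g₁} {g} {p} placed =
  trans (cong (at p) (sym (pos-one g₁ g))) (placed 1 (s≤s z≤n) (s≤s z≤n)) , placed′
  where
  placed′ : PlacedAt π g (drop (suc g₁) p)
  placed′ (suc j) _ j<k = begin
    at (drop (suc g₁) p) (pos g (suc j)) ≡⟨ at-drop (suc g₁) p (pos-positive g j) ⟨
    at p (suc g₁ + pos g (suc j))       ≡⟨ cong (at p) (pos-∷ g₁ g j) ⟨
    at p (pos (g₁ ∷ g) (suc (suc j)))   ≡⟨ placed (suc (suc j)) (s≤s z≤n) (s≤s j<k) ⟩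
    at π (suc j)                        ∎
    where open ≡-Reasoning

PlacedAt-∷⁺ : ∀ {x π g₁ g p} → at p (suc g₁) ≡ just x → PlacedAt π g (drop (suc g₁) p) → PlacedAt (x ∷ π) (g₁ ∷ g) p
PlacedAt-∷⁺ {g₁ = g₁} {g} {p} atx placed (suc zero)    _ _         = trans (cong (at p) (pos-one g₁ g)) atx
PlacedAt-∷⁺ {g₁ = g₁} {g} {p} atx placed (suc (suc j)) _ (s≤s j<k) =
  trans (cong (at p) (pos-∷ g₁ g j)) (trans (at-drop (suc g₁) p (pos-positive g j)) (placed (suc j) (s≤s z≤n) j<k))

at-suc-length-++ : ∀ (G : List ℕ) x w → at (G ++ x ∷ w) (suc (length G)) ≡ just x
at-suc-length-++ []          x w = refl
at-suc-length-++ (y ∷ [])    x w = refl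
at-suc-length-++ (y ∷ z ∷ G) x w = at-suc-length-++ (z ∷ G) x w

drop-suc-length-++ : ∀ (G : List ℕ) x w → drop (suc (length G)) (G ++ x ∷ w) ≡ w
drop-suc-length-++ []      x w = refl
drop-suc-length-++ (y ∷ G) x w = drop-suc-length-++ G x w

at-split : ∀ n (p : List ℕ) {y} → at p (suc n) ≡ just y → p ≡ take n p ++ y ∷ drop (suc n) p
at-split zero    (z ∷ p) refl = refl
at-split (suc n) (z ∷ p) e    = cong (z ∷_) (at-split n p e)

interleave-placed : ∀ Gs π → length Gs ≡ suc (length π) → PlacedAt π (map length Gs) (interleave Gs π)
interleave-placed (G ∷ [])      []      _  (suc i) _ ()
interleave-placed (G ∷ G′ ∷ Gs) (x ∷ π) lG =
  PlacedAt-∷⁺ {x} {π} {length G} {map length (G′ ∷ Gs)} {G ++ x ∷ interleave (G′ ∷ Gs) π} (at-suc-length-++ G x _)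
    (subst (PlacedAt π (map length (G′ ∷ Gs))) (sym (drop-suc-length-++ G x _)) (interleave-placed (G′ ∷ Gs) π (suc-injective lG)))

placed⇒interleave : ∀ π g p → length g ≡ suc (length π) → length p ≡ length π + sum g → PlacedAt π g p →
  ∃ λ Gs → map length Gs ≡ g × p ≡ interleave Gs π
placed⇒interleave []      (g₁ ∷ []) p _  lp _      = p ∷ [] , cong (_∷ []) (trans lp (+-identityʳ g₁)) , refl
placed⇒interleave (x ∷ π) (g₁ ∷ g)  p lg lp placed with PlacedAt-∷⁻ {x} {π} {g₁} {g} {p} placed
... | atx , placed′ with placed⇒interleave π g (drop (suc g₁) p) (suc-injective lg) (length-drop-suc p (length π) g₁ (sum g) lp) placed′
... | Gs , lens , p≡ = take g₁ p ∷ Gs ,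
  cong₂ _∷_ (length-take-≤ g₁ p (<⇒≤ (<-length-suc p (length π) g₁ (sum g) lp))) lens ,
  trans (at-split g₁ p atx) (cong (λ t → take g₁ p ++ x ∷ t) p≡)

-- Filling the gaps

fill : List ℕ → List ℕ → List ℕ → List ℕ
fill τ g h = interleave (cut g (map (length τ +_) h)) τ

interleave-↭ : ∀ (Gs : List (List ℕ)) xs → length Gs ≡ suc (length xs) → interleave Gs xs ↭ concat Gs ++ xs
interleave-↭ (G ∷ [])      []       _  = ↭-reflexive (sym (trans (++-identityʳ (G ++ [])) (++-identityʳ G)))
interleave-↭ (G ∷ G′ ∷ Gs) (x ∷ xs) lG = begin
  G ++ x ∷ interleave (G′ ∷ Gs) xs    ↭⟨ ↭.++⁺ˡ G (prep x (interleave-↭ (G′ ∷ Gs) xs (suc-injective lG))) ⟩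
  G ++ x ∷ concat (G′ ∷ Gs) ++ xs     ↭⟨ ↭.++⁺ˡ G (↭-sym (↭.shift x (concat (G′ ∷ Gs)) xs)) ⟩
  G ++ concat (G′ ∷ Gs) ++ x ∷ xs     ≡⟨ ++-assoc G (concat (G′ ∷ Gs)) (x ∷ xs) ⟨
  concat (G ∷ G′ ∷ Gs) ++ x ∷ xs      ∎
  where open PermutationReasoning

Unique-resp-↭ : ∀ {xs ys : List ℕ} → xs ↭ ys → Unique xs → Unique ys
Unique-resp-↭ xs↭ys = ↭ₛ.Unique-resp-↭ (setoid ℕ) (↭⇒↭ₛ xs↭ys)

module _ {τ : List ℕ} (τ-perm : IsPerm τ) (g : List ℕ) (g-gap : IsGap τ g) where

  private
    k = length τ
    m = sum g
    blocks : List ℕ → List (List ℕ)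
    blocks h = cut g (map (k +_) h)

  length-cut-gap : ∀ {a} {A : Set a} (w : List A) → length (cut g w) ≡ suc k
  length-cut-gap w = trans (length-cut g w) g-gap

  fill-↭ : ∀ {h} → length h ≡ m → fill τ g h ↭ map (k +_) h ++ τ
  fill-↭ {h} lh = ↭-trans (interleave-↭ (blocks h) τ (length-cut-gap (map (k +_) h)))
    (↭-reflexive (cong (_++ τ) (concat-cut g _ (trans (length-map _ h) lh))))

  fill-isPerm : ∀ {h} → h ∈ perms m → IsPerm (fill τ g h) × length (fill τ g h) ≡ k + m
  fill-isPerm {h} h∈ with ∈-perms⁻ h∈
  ... | (uh , bh) , lh = (Unique-resp-↭ (↭-sym fill↭) unique , All.tabulate bounded) , length-fill
    where
    fill↭ = fill-↭ lh
    length-fill : length (fill τ g h) ≡ k + m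
    length-fill = trans (↭.↭-length fill↭)
      (trans (length-++ (map (k +_) h)) (trans (cong (_+ k) (trans (length-map _ h) lh)) (+-comm m k)))
    unique : Unique (map (k +_) h ++ τ)
    unique = Unique.++⁺ (Unique.map⁺ (+-cancelˡ-≡ k _ _) uh) (proj₁ τ-perm) λ (v∈h , v∈τ) → disjoint v∈h v∈τ
      where
      disjoint : ∀ {v} → v ∈ map (k +_) h → v ∉ τ
      disjoint v∈h v∈τ with ∈-map⁻ (k +_) v∈h
      ... | x , x∈ , refl = <-irrefl refl (<-≤-trans (m<m+n k (proj₁ (All.lookup bh x∈))) (proj₂ (All.lookup (proj₂ τ-perm) v∈τ)))
    bounded : ∀ {v} → v ∈ fill τ g h → 1 ≤ v × v ≤ length (fill τ g h)
    bounded v∈ with ∈-++⁻ (map (k +_) h) (↭.∈-resp-↭ fill↭ v∈)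
    ... | inj₂ v∈τ = let 1≤v , v≤k = All.lookup (proj₂ τ-perm) v∈τ in
                     1≤v , subst (_ ≤_) (sym length-fill) (≤-trans v≤k (m≤m+n k m))
    ... | inj₁ v∈h with ∈-map⁻ (k +_) v∈h
    ...   | x , x∈ , refl = let 1≤x , x≤m = All.lookup bh x∈ in
                            ≤-trans 1≤x (m≤n+m x k) , subst (k + x ≤_) (sym length-fill) (+-monoʳ-≤ k (subst (x ≤_) lh x≤m))

  fill-placed : ∀ {h} → length h ≡ m → PlacedAt τ g (fill τ g h)
  fill-placed {h} lh = subst (λ g′ → PlacedAt τ g′ (fill τ g h)) lens
    (interleave-placed (blocks h) τ (length-cut-gap (map (k +_) h)))
    where
    lens : map length (blocks h) ≡ g
    lens = map-length-cut g _ (trans (length-map _ h) lh)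

  fill-injective : ∀ {h h′} → length h ≡ m → length h′ ≡ m → fill τ g h ≡ fill τ g h′ → h ≡ h′
  fill-injective {h} {h′} lh lh′ e = map-injective (+-cancelˡ-≡ k _ _) (begin
    map (k +_) h              ≡⟨ concat-cut g _ l ⟨
    concat (blocks h)         ≡⟨ cong concat (interleave-injective (blocks h) (blocks h′) τ (length-cut-gap _)
                                    (trans (map-length-cut g _ l) (sym (map-length-cut g _ l′))) e) ⟩
    concat (blocks h′)        ≡⟨ concat-cut g _ l′ ⟩
    map (k +_) h′             ∎)
    where
    open ≡-Reasoning
    l  = trans (length-map (k +_) h) lh
    l′ = trans (length-map (k +_) h′) lh′

  fill-surjective : ∀ {p} → p ∈ perms (k + m) → PlacedAt τ g p → ∃ λ h → h ∈ perms m × p ≡ fill τ g h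
  fill-surjective {p} p∈ placed with ∈-perms⁻ p∈
  ... | (up , bp) , lp with placed⇒interleave τ g p g-gap lp placed
  ... | Gs , lens , refl = h , subst (λ n → h ∈ perms n) lh (∈-perms⁺ (uh , bh)) , cong (λ Hs → interleave Hs τ) (sym Gs≡)
    where
    gap-↭ : interleave Gs τ ↭ concat Gs ++ τ
    gap-↭ = interleave-↭ Gs τ (trans (sym (length-map length Gs)) (trans (cong length lens) g-gap))
    unique : Unique (concat Gs ++ τ)
    unique = Unique-resp-↭ gap-↭ up
    -- the pattern entries exhaust [1, k], so the gap entries lie in (k, k + m]
    large : ∀ {v} → v ∈ concat Gs → k < v × v ≤ k + m
    large {v} v∈ with All.lookup bp (↭.∈-resp-↭ (↭-sym gap-↭) (∈-++⁺ˡ v∈))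
    ... | 1≤v , v≤ with v ≤? k
    ...   | yes v≤k = ⊥-elim (Unique-++⇒disjoint (concat Gs) unique v∈ (IsPerm⇒∈ τ-perm 1≤v v≤k))
    ...   | no  v≰k = ≰⇒> v≰k , subst (v ≤_) lp v≤
    h = map (_∸ k) (concat Gs)
    lh : length h ≡ m
    lh = trans (length-map _ (concat Gs)) (trans (length-concat Gs) (cong sum lens))
    k+h≡ : map (k +_) h ≡ concat Gs
    k+h≡ = trans (sym (map-∘ (concat Gs))) (map-id-local (All.tabulate λ v∈ → m+[n∸m]≡n (<⇒≤ (proj₁ (large v∈)))))
    uh : Unique h
    uh = Unique.map⁻ (subst Unique (sym k+h≡) (Unique-++⇒uniqueˡ (concat Gs) unique))
    bh : All (λ x → 1 ≤ x × x ≤ length h) h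
    bh = All-map⁺ (All.tabulate λ {v} v∈ → let k<v , v≤k+m = large v∈ in
      m<n⇒0<n∸m k<v , subst (v ∸ k ≤_) (sym lh) (subst (v ∸ k ≤_) (m+n∸m≡n k m) (∸-monoˡ-≤ k v≤k+m)))
    Gs≡ : blocks h ≡ Gs
    Gs≡ = trans (cong (cut g) k+h≡) (trans (cong (λ g′ → cut g′ (concat Gs)) (sym lens)) (cut-concat Gs))

  module _ (B : List (List ℕ)) where

    private
      inZ? = λ p → avoidsAll? B p ×-dec placed? τ g p
      avoids? = λ h → avoidsAll? B (fill τ g h)

    ∈-Z⁺ : ∀ {h} → h ∈ perms m → AvoidsAll B (fill τ g h) → fill τ g h ∈ Z B τ g
    ∈-Z⁺ {h} h∈ avoids with fill-isPerm h∈
    ... | isPerm , length-fill = ∈-filter⁺ inZ? (subst (λ n → fill τ g h ∈ perms n) length-fill (∈-perms⁺ isPerm))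
      (avoids , PlacedAt⇒Placed {τ} {g} {fill τ g h} (fill-placed (proj₂ (∈-perms⁻ h∈))))

    ∈-Z⁻ : ∀ {p} → p ∈ Z B τ g → ∃ λ h → h ∈ perms m × AvoidsAll B (fill τ g h) × p ≡ fill τ g h
    ∈-Z⁻ {p} p∈ with ∈-filter⁻ inZ? {xs = perms (k + m)} p∈
    ... | p∈perms , avoids , placed with fill-surjective p∈perms (Placed⇒PlacedAt {τ} {g} {p} placed)
    ...   | h , h∈ , refl = h , h∈ , avoids , refl

    cardZ-fill : cardZ B τ g ≡ length (filter avoids? (perms m))
    cardZ-fill = trans (Unique⇒length-≡ (Unique.filter⁺ inZ? (perms-unique (k + m))) unique-fills Z⊆fills fills⊆Z)
                       (length-map (fill τ g) (filter avoids? (perms m)))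
      where
      unique-fills : Unique (map (fill τ g) (filter avoids? (perms m)))
      unique-fills = Unique-map⁺-on (fill τ g)
        (λ h∈ h′∈ → fill-injective (length-perm h∈) (length-perm h′∈)) (Unique.filter⁺ avoids? (perms-unique m))
        where
        length-perm : ∀ {h} → h ∈ filter avoids? (perms m) → length h ≡ m
        length-perm h∈ = proj₂ (∈-perms⁻ (proj₁ (∈-filter⁻ avoids? {xs = perms m} h∈)))
      Z⊆fills : ∀ {p} → p ∈ Z B τ g → p ∈ map (fill τ g) (filter avoids? (perms m))
      Z⊆fills p∈ with ∈-Z⁻ p∈
      ... | h , h∈ , avoids , refl = ∈-map⁺ (fill τ g) (∈-filter⁺ avoids? h∈ avoids)
      fills⊆Z : ∀ {p} → p ∈ map (fill τ g) (filter avoids? (perms m)) → p ∈ Z B τ g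
      fills⊆Z p∈ with ∈-map⁻ (fill τ g) p∈
      ... | h , h∈ , refl with ∈-filter⁻ avoids? {xs = perms m} h∈
      ...   | h∈perms , avoids = ∈-Z⁺ h∈perms avoids

shifted-above : ∀ {n x h} → All (_≤ n) x → All (1 ≤_) h → ∀ {a c} → a ∈ map (n +_) h → c ∈ x → c < a
shifted-above {n} x≤n 1≤h a∈ c∈ with ∈-map⁻ (n +_) a∈
... | y , y∈ , refl = ≤-<-trans (All.lookup x≤n c∈) (m<m+n n (All.lookup 1≤h y∈))

-- Deleting a pattern entry

deleteAt-⊆ : ∀ r (xs : List ℕ) → deleteAt r xs ⊆ xs
deleteAt-⊆ r             []       = []
deleteAt-⊆ zero          (x ∷ xs) = ⊆-refl
deleteAt-⊆ (suc zero)    (x ∷ xs) = x ∷ʳ ⊆-refl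
deleteAt-⊆ (suc (suc r)) (x ∷ xs) = refl ∷ deleteAt-⊆ (suc r) xs

length-deleteAt : ∀ r (xs : List ℕ) → 1 ≤ r → r ≤ length xs → suc (length (deleteAt r xs)) ≡ length xs
length-deleteAt (suc zero)    (x ∷ xs)     _ _          = refl
length-deleteAt (suc (suc r)) (x ∷ y ∷ xs) _ (s≤s r≤k) = cong suc (length-deleteAt (suc r) (y ∷ xs) (s≤s z≤n) r≤k)

length-dg : ∀ r (g : List ℕ) k → 1 ≤ r → r ≤ k → length g ≡ suc k → length (dg r g) ≡ k
length-dg (suc zero)    (x ∷ [])    zero    _ ()         _
length-dg (suc zero)    (x ∷ y ∷ g) k       _ _          lg = suc-injective lg
length-dg (suc (suc r)) (x ∷ y ∷ g) (suc k) _ (s≤s r≤k) lg =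
  cong suc (length-dg (suc r) (y ∷ g) k (s≤s z≤n) r≤k (suc-injective lg))

sum-dg : ∀ r g → sum (dg r g) ≡ sum g
sum-dg r             []          = refl
sum-dg r             (x ∷ [])    = refl
sum-dg zero          (x ∷ y ∷ g) = refl
sum-dg (suc zero)    (x ∷ y ∷ g) = +-assoc x y (sum g)
sum-dg (suc (suc r)) (x ∷ y ∷ g) = cong (x +_) (sum-dg (suc r) (y ∷ g))

interleave-++ : ∀ (G H : List ℕ) Gs xs → interleave ((G ++ H) ∷ Gs) xs ≡ G ++ interleave (H ∷ Gs) xs
interleave-++ G H Gs []       = refl
interleave-++ G H Gs (x ∷ xs) = ++-assoc G H _

interleave-mergeAt-⊆ : ∀ r (Gs : List (List ℕ)) xs → 1 ≤ r → r ≤ length xs → length Gs ≡ suc (length xs) →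
  interleave (mergeAt r Gs) (deleteAt r xs) ⊆ interleave Gs xs
interleave-mergeAt-⊆ (suc zero) (G ∷ H ∷ Gs) (x ∷ xs) _ _ _ =
  subst (_⊆ G ++ x ∷ interleave (H ∷ Gs) xs) (sym (interleave-++ G H Gs xs)) (++⁺ ⊆-refl (x ∷ʳ ⊆-refl))
interleave-mergeAt-⊆ (suc (suc r)) (G ∷ H ∷ Gs) (x ∷ y ∷ xs) _ (s≤s r≤k) lG =
  ++⁺ ⊆-refl (refl ∷ interleave-mergeAt-⊆ (suc r) (H ∷ Gs) (y ∷ xs) (s≤s z≤n) r≤k (suc-injective lG))

dπ-isPerm : ∀ r {π} → IsPerm π → IsPerm (dπ r π)
dπ-isPerm r {π} π-perm = st-isPerm (Unique-resp-⊇ (deleteAt-⊆ r π) (proj₁ π-perm))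

fill-dπ-≅ : ∀ π r g h → IsPerm π → 1 ≤ r → r ≤ length π → All (1 ≤_) h →
  fill (dπ r π) (dg r g) h ≅ interleave (mergeAt r (cut g (map (length π +_) h))) (deleteAt r π)
fill-dπ-≅ π r g h π-perm 1≤r r≤k 1≤h =
  subst (λ Gs → fill τ (dg r g) h ≅ interleave Gs σ) (cut-dg r g _)
    (interleave-cut-≅ (dg r g) (map-+-≅ (length τ) k ≅-refl) (st-≅ σ)
      (shifted-above (All.map proj₂ (proj₂ (dπ-isPerm r π-perm))) 1≤h)
      (shifted-above (All-resp-⊆ (deleteAt-⊆ r π) (All.map proj₂ (proj₂ π-perm))) 1≤h))
  where
  k = length π
  σ = deleteAt r π
  τ = dπ r π

-- Selecting subsequences by masks

countTrue : List Bool → ℕ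
countTrue []           = 0
countTrue (true ∷ bs)  = suc (countTrue bs)
countTrue (false ∷ bs) = countTrue bs

countTrue-++ : ∀ bs cs → countTrue (bs ++ cs) ≡ countTrue bs + countTrue cs
countTrue-++ []           cs = refl
countTrue-++ (true ∷ bs)  cs = cong suc (countTrue-++ bs cs)
countTrue-++ (false ∷ bs) cs = countTrue-++ bs cs

countTrue-concat : ∀ Os → countTrue (concat Os) ≡ sum (map countTrue Os)
countTrue-concat []       = refl
countTrue-concat (O ∷ Os) = trans (countTrue-++ O (concat Os)) (cong (countTrue O +_) (countTrue-concat Os))

countTrue-interleave : ∀ Os bs → length Os ≡ suc (length bs) → countTrue (interleave Os bs) ≡ countTrue (concat Os) + countTrue bs
countTrue-interleave (O ∷ [])      []       _  = trans (cong countTrue (sym (++-identityʳ O))) (sym (+-identityʳ _))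
countTrue-interleave (O ∷ O′ ∷ Os) (b ∷ bs) lO = begin
  countTrue (O ++ b ∷ interleave (O′ ∷ Os) bs)            ≡⟨ countTrue-++ O _ ⟩
  countTrue O + countTrue (b ∷ interleave (O′ ∷ Os) bs)    ≡⟨ cong (countTrue O +_) (countTrue-∷ b (interleave (O′ ∷ Os) bs)) ⟩
  countTrue O + (countTrue [ b ] + countTrue (interleave (O′ ∷ Os) bs))
    ≡⟨ cong (λ t → countTrue O + (countTrue [ b ] + t)) (countTrue-interleave (O′ ∷ Os) bs (suc-injective lO)) ⟩
  countTrue O + (countTrue [ b ] + (countTrue (concat (O′ ∷ Os)) + countTrue bs))
    ≡⟨ trans (sym (+-assoc (countTrue O) (countTrue [ b ]) _))
             (+-interchange (countTrue O) (countTrue [ b ]) (countTrue (concat (O′ ∷ Os))) (countTrue bs)) ⟩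
  (countTrue O + countTrue (concat (O′ ∷ Os))) + (countTrue [ b ] + countTrue bs)
    ≡⟨ cong₂ _+_ (sym (countTrue-++ O _)) (sym (countTrue-∷ b bs)) ⟩
  countTrue (concat (O ∷ O′ ∷ Os)) + countTrue (b ∷ bs)    ∎
  where
  open ≡-Reasoning
  countTrue-∷ : ∀ b bs → countTrue (b ∷ bs) ≡ countTrue [ b ] + countTrue bs
  countTrue-∷ b bs = countTrue-++ [ b ] bs

bitAt : List Bool → ℕ → Bool
bitAt []       _             = false
bitAt (b ∷ bs) zero          = false
bitAt (b ∷ bs) (suc zero)    = b
bitAt (b ∷ bs) (suc (suc r)) = bitAt bs (suc r)

bitAt-true⇒countTrue-positive : ∀ r bs → bitAt bs r ≡ true → 1 ≤ countTrue bs
bitAt-true⇒countTrue-positive (suc zero)    (true ∷ bs)  _ = s≤s z≤n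
bitAt-true⇒countTrue-positive (suc (suc r)) (true ∷ bs)  _ = s≤s z≤n
bitAt-true⇒countTrue-positive (suc (suc r)) (false ∷ bs) e = bitAt-true⇒countTrue-positive (suc r) bs e

interleave-≤ᵇ-trues : ∀ Os bs → Pointwise _≤ᵇ_ (interleave Os bs) (interleave Os (replicate (length bs) true))
interleave-≤ᵇ-trues []       _        = []
interleave-≤ᵇ-trues (O ∷ Os) []       = Pointwise.refl b≤b
interleave-≤ᵇ-trues (O ∷ Os) (b ∷ bs) = Pointwise.++⁺ (Pointwise.refl b≤b) (≤ᵇ-maximum b ∷ interleave-≤ᵇ-trues Os bs)

module _ {a} {A : Set a} where

  select : List Bool → List A → List A
  select []           _        = []
  select (_ ∷ _)      []       = []
  select (true ∷ bs)  (x ∷ xs) = x ∷ select bs xs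
  select (false ∷ bs) (x ∷ xs) = select bs xs

  select-⊆ : ∀ bs (xs : List A) → select bs xs ⊆ xs
  select-⊆ []           xs       = minimum xs
  select-⊆ (_ ∷ _)      []       = []
  select-⊆ (true ∷ bs)  (x ∷ xs) = refl ∷ select-⊆ bs xs
  select-⊆ (false ∷ bs) (x ∷ xs) = x ∷ʳ select-⊆ bs xs

  ⊆⇒select : ∀ {s xs : List A} → s ⊆ xs → ∃ λ bs → length bs ≡ length xs × s ≡ select bs xs
  ⊆⇒select []          = [] , refl , refl
  ⊆⇒select (x ∷ʳ s⊆)   with ⊆⇒select s⊆
  ... | bs , l , e = false ∷ bs , cong suc l , e
  ⊆⇒select (refl ∷ s⊆) with ⊆⇒select s⊆
  ... | bs , l , e = true ∷ bs , cong suc l , cong (_ ∷_) e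

  select-mono : ∀ {bs cs} → Pointwise _≤ᵇ_ bs cs → (xs : List A) → length bs ≡ length xs → select bs xs ⊆ select cs xs
  select-mono []          []       _ = []
  select-mono (f≤t ∷ bs≤) (x ∷ xs) l = x ∷ʳ select-mono bs≤ xs (suc-injective l)
  select-mono (_∷_ {true}  b≤b bs≤) (x ∷ xs) l = refl ∷ select-mono bs≤ xs (suc-injective l)
  select-mono (_∷_ {false} b≤b bs≤) (x ∷ xs) l = select-mono bs≤ xs (suc-injective l)

  select-++ : ∀ bs cs (xs ys : List A) → length bs ≡ length xs → select (bs ++ cs) (xs ++ ys) ≡ select bs xs ++ select cs ys
  select-++ []           cs []       ys _ = refl
  select-++ (true ∷ bs)  cs (x ∷ xs) ys l = cong (x ∷_) (select-++ bs cs xs ys (suc-injective l))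
  select-++ (false ∷ bs) cs (x ∷ xs) ys l = select-++ bs cs xs ys (suc-injective l)

  length-select : ∀ bs (xs : List A) → length bs ≡ length xs → length (select bs xs) ≡ countTrue bs
  length-select []           []       _ = refl
  length-select (true ∷ bs)  (x ∷ xs) l = cong suc (length-select bs xs (suc-injective l))
  length-select (false ∷ bs) (x ∷ xs) l = length-select bs xs (suc-injective l)

  select-interleave-trues : ∀ Os (Gs : List (List A)) xs → map length Os ≡ map length Gs → length Gs ≡ suc (length xs) →
    select (interleave Os (replicate (length xs) true)) (interleave Gs xs) ≡ interleave (zipWith select Os Gs) xs
  select-interleave-trues (O ∷ [])      (G ∷ [])      []       _    _  = refl
  select-interleave-trues (O ∷ O′ ∷ Os) (G ∷ G′ ∷ Gs) (x ∷ xs) lens lG with ∷-injective lens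
  ... | |O|≡|G| , lens′ = trans (select-++ O _ G _ |O|≡|G|)
    (cong (λ t → select O G ++ x ∷ t) (select-interleave-trues (O′ ∷ Os) (G′ ∷ Gs) xs lens′ (suc-injective lG)))

  select-cut : ∀ Os (w : List A) → length w ≡ sum (map length Os) →
    zipWith select Os (cut (map length Os) w) ≡ cut (map countTrue Os) (select (concat Os) w)
  select-cut []       w _  = refl
  select-cut (O ∷ Os) w lw = begin
    S ∷ zipWith select Os (cut (map length Os) (drop (length O) w))
      ≡⟨ cong (S ∷_) (select-cut Os (drop (length O) w) length-rest) ⟩
    S ∷ cut (map countTrue Os) R
      ≡⟨ cong₂ (λ X Y → X ∷ cut (map countTrue Os) Y) (take-length-++ S R) (drop-length-++ S R) ⟨
    cut (length S ∷ map countTrue Os) (S ++ R)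
      ≡⟨ cong (λ n → cut (n ∷ map countTrue Os) (S ++ R)) |S|≡ ⟩
    cut (countTrue O ∷ map countTrue Os) (S ++ R)
      ≡⟨ cong (λ t → cut (countTrue O ∷ map countTrue Os) t) (select-++ O (concat Os) (take (length O) w) _ (sym |take|)) ⟨
    cut (countTrue O ∷ map countTrue Os) (select (O ++ concat Os) (take (length O) w ++ drop (length O) w))
      ≡⟨ cong (λ t → cut (countTrue O ∷ map countTrue Os) (select (O ++ concat Os) t)) (take++drop≡id (length O) w) ⟩
    cut (countTrue O ∷ map countTrue Os) (select (O ++ concat Os) w) ∎
    where
    open ≡-Reasoning
    |take| : length (take (length O) w) ≡ length O
    |take| = length-take-≤ (length O) w (subst (length O ≤_) (sym lw) (m≤m+n _ _))
    length-rest : length (drop (length O) w) ≡ sum (map length Os)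
    length-rest = trans (length-drop (length O) w) (trans (cong (_∸ length O) lw) (m+n∸m≡n (length O) _))
    S = select O (take (length O) w)
    R = select (concat Os) (drop (length O) w)
    |S|≡ : length S ≡ countTrue O
    |S|≡ = length-select O _ (sym |take|)

select-map : ∀ {a b} {A : Set a} {B : Set b} (f : A → B) bs xs → select bs (map f xs) ≡ map f (select bs xs)
select-map f []           xs       = refl
select-map f (_ ∷ _)      []       = refl
select-map f (true ∷ bs)  (x ∷ xs) = cong (f x ∷_) (select-map f bs xs)
select-map f (false ∷ bs) (x ∷ xs) = select-map f bs xs

-- Occurrences in a filled permutation

select-bitAt-false-⊆ : ∀ r Os bs (Gs : List (List ℕ)) xs → bitAt bs r ≡ false → map length Os ≡ map length Gs →
  length bs ≡ length xs → 1 ≤ r → r ≤ length xs → length Gs ≡ suc (length xs) →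
  select (interleave Os bs) (interleave Gs xs) ⊆ interleave (mergeAt r Gs) (deleteAt r xs)
select-bitAt-false-⊆ (suc zero) (O ∷ O′ ∷ Os) (false ∷ bs) (G ∷ G′ ∷ Gs) (x ∷ xs) _ lens _ _ _ _ =
  subst₂ _⊆_ (sym (select-++ O _ G _ (proj₁ (∷-injective lens)))) (sym (interleave-++ G G′ Gs xs))
    (++⁺ (select-⊆ O G) (select-⊆ (interleave (O′ ∷ Os) bs) (interleave (G′ ∷ Gs) xs)))
select-bitAt-false-⊆ (suc (suc r)) (O ∷ O′ ∷ Os) (b ∷ bs) (G ∷ G′ ∷ Gs) (x ∷ xs) bit lens |bs| _ (s≤s r≤k) lG =
  subst (_⊆ G ++ x ∷ _) (sym (select-++ O _ G _ (proj₁ (∷-injective lens)))) (++⁺ (select-⊆ O G) (step b))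
  where
  rest = select-bitAt-false-⊆ (suc r) (O′ ∷ Os) bs (G′ ∷ Gs) xs bit (proj₂ (∷-injective lens))
           (suc-injective |bs|) (s≤s z≤n) r≤k (suc-injective lG)
  step : ∀ b → select (b ∷ interleave (O′ ∷ Os) bs) (x ∷ interleave (G′ ∷ Gs) xs)
                 ⊆ x ∷ interleave (mergeAt (suc r) (G′ ∷ Gs)) (deleteAt (suc r) xs)
  step true  = refl ∷ rest
  step false = x ∷ʳ rest

fill-select-≅ : ∀ τ Os h → All (_≤ length τ) τ → All (1 ≤_) h → length Os ≡ suc (length τ) → length h ≡ sum (map length Os) →
  fill τ (map countTrue Os) (st (select (concat Os) h)) ≅ select (interleave Os (replicate (length τ) true)) (fill τ (map length Os) h)
fill-select-≅ τ Os h τ≤k 1≤h lOs lh = subst (fill τ (map countTrue Os) (st u) ≅_) (sym selected-fill)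
  (interleave-cut-≅ (map countTrue Os) (map-+-≅ k k (st-≅ u)) ≅-refl
    (shifted-above τ≤k (st-positive u)) (shifted-above τ≤k (All-resp-⊆ (select-⊆ (concat Os) h) 1≤h)))
  where
  open ≡-Reasoning
  k = length τ
  u = select (concat Os) h
  |k+h| : length (map (k +_) h) ≡ sum (map length Os)
  |k+h| = trans (length-map _ h) lh
  selected-fill : select (interleave Os (replicate k true)) (fill τ (map length Os) h)
                  ≡ interleave (cut (map countTrue Os) (map (k +_) u)) τ
  selected-fill = begin
    select (interleave Os (replicate k true)) (interleave (cut (map length Os) (map (k +_) h)) τ)
      ≡⟨ select-interleave-trues Os (cut (map length Os) (map (k +_) h)) τ (sym (map-length-cut _ _ |k+h|))
           (trans (length-cut (map length Os) (map (k +_) h)) (trans (length-map length Os) lOs)) ⟩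
    interleave (zipWith select Os (cut (map length Os) (map (k +_) h))) τ
      ≡⟨ cong (λ Gs → interleave Gs τ) (select-cut Os (map (k +_) h) |k+h|) ⟩
    interleave (cut (map countTrue Os) (select (concat Os) (map (k +_) h))) τ
      ≡⟨ cong (λ w → interleave (cut (map countTrue Os) w) τ) (select-map (k +_) (concat Os) h) ⟩
    interleave (cut (map countTrue Os) (map (k +_) u)) τ ∎

length-≤-maxLen : ∀ {β} B → β ∈ B → length β ≤ maxLen B
length-≤-maxLen (β ∷ B) (here refl) = m≤m⊔n (length β) (maxLen B)
length-≤-maxLen (β ∷ B) (there β∈)  = ≤-trans (length-≤-maxLen B β∈) (m≤n⊔m (length β) (maxLen B))

-- The reduction

module Reduction (B : List (List ℕ)) {π : List ℕ} (π-perm : IsPerm π) {r : ℕ} (1≤r : 1 ≤ r) (r≤k : r ≤ length π) where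

  private
    k = length π
    τ = dπ r π

    τ-perm : IsPerm τ
    τ-perm = dπ-isPerm r π-perm

    1+|τ| : suc (length τ) ≡ k
    1+|τ| = trans (cong suc (length-map _ (deleteAt r π))) (length-deleteAt r π 1≤r r≤k)

    π≤k : All (_≤ k) π
    π≤k = All.map proj₂ (proj₂ π-perm)

    τ≤|τ| : All (_≤ length τ) τ
    τ≤|τ| = All.map proj₂ (proj₂ τ-perm)

    positive : ∀ {h} n → h ∈ perms n → All (1 ≤_) h
    positive n h∈ = All.map proj₁ (proj₂ (proj₁ (∈-perms⁻ {n} h∈)))

  dg-gap : ∀ g → IsGap π g → IsGap τ (dg r g)
  dg-gap g gap = trans (length-dg r g k 1≤r r≤k gap) (sym 1+|τ|)

  Good Goodᵈ : List ℕ → List ℕ → Set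
  Good  g h = AvoidsAll B (fill π g h)
  Goodᵈ g h = AvoidsAll B (fill τ (dg r g) h)

  good? : ∀ g h → Dec (Good g h)
  good? g h = avoidsAll? B (fill π g h)

  goodᵈ? : ∀ g h → Dec (Goodᵈ g h)
  goodᵈ? g h = avoidsAll? B (fill τ (dg r g) h)

  cardZ-π : ∀ g → IsGap π g → cardZ B π g ≡ length (filter (good? g) (perms (norm g)))
  cardZ-π g gap = cardZ-fill π-perm g gap B

  cardZ-τ : ∀ g → IsGap π g → cardZ B τ (dg r g) ≡ length (filter (goodᵈ? g) (perms (norm g)))
  cardZ-τ g gap = subst (λ n → cardZ B τ (dg r g) ≡ length (filter (goodᵈ? g) (perms n))) (sum-dg r g)
    (cardZ-fill τ-perm (dg r g) (dg-gap g gap) B)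

  good⇒goodᵈ : ∀ g {h} → IsGap π g → h ∈ perms (norm g) → Good g h → Goodᵈ g h
  good⇒goodᵈ g {h} gap h∈ good = AvoidsAll-resp-≅ (fill-dπ-≅ π r g h π-perm 1≤r r≤k (positive (norm g) h∈))
    (AvoidsAll-resp-⊇ (interleave-mergeAt-⊆ r (cut g (map (k +_) h)) π 1≤r r≤k (length-cut-gap π-perm g gap (map (k +_) h))) good)

  record Counterexample (g : List ℕ) : Set where
    field
      gap        : IsGap π g
      Z-nonempty : ¬ Z B π g ≡ []
      witness    : List ℕ
      witness∈   : witness ∈ perms (norm g)
      goodᵈ      : Goodᵈ g witness
      ¬good      : ¬ Good g witness

  counterexample⇒cardZ-< : ∀ {g} → Counterexample g → cardZ B π g < cardZ B τ (dg r g)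
  counterexample⇒cardZ-< {g} ce = subst₂ _<_ (sym (cardZ-π g gap)) (sym (cardZ-τ g gap))
    (length-filter-< (good? g) (goodᵈ? g) (perms (norm g)) (good⇒goodᵈ g gap) witness∈ goodᵈ ¬good)
    where open Counterexample ce

  cardZ-≡-or-counterexample : ∀ g → IsGap π g → ¬ Z B π g ≡ [] → cardZ B π g ≡ cardZ B τ (dg r g) ⊎ Counterexample g
  cardZ-≡-or-counterexample g gap Z≢[] with all? (λ h → goodᵈ? g h →-dec good? g h) (perms (norm g))
  ... | yes goodᵈ⇒good = inj₁ (trans (cardZ-π g gap) (trans
          (length-filter-cong (good? g) (goodᵈ? g) (perms (norm g)) (good⇒goodᵈ g gap) (All.lookup goodᵈ⇒good))
          (sym (cardZ-τ g gap))))
  ... | no ¬goodᵈ⇒good with find (¬All⇒Any¬ (λ h → goodᵈ? g h →-dec good? g h) (perms (norm g)) ¬goodᵈ⇒good)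
  ...   | h , h∈ , ¬[goodᵈ⇒good] with goodᵈ? g h | good? g h
  ...     | yes goodᵈ | no ¬good =
    inj₂ (record { gap = gap ; Z-nonempty = Z≢[] ; witness = h ; witness∈ = h∈ ; goodᵈ = goodᵈ ; ¬good = ¬good })
  ...     | _         | yes good = ⊥-elim (¬[goodᵈ⇒good] (λ _ → good))
  ...     | no ¬goodᵈ | _        = ⊥-elim (¬[goodᵈ⇒good] (λ goodᵈ → ⊥-elim (¬goodᵈ goodᵈ)))

  record BlockOccurrence (g h β : List ℕ) : Set where
    field
      blocks        : List (List Bool)
      bits          : List Bool
      blocks-length : map length blocks ≡ g
      bits-length   : length bits ≡ k
      mask-length   : length (interleave blocks bits) ≡ length (fill π g h)
      occurs        : st (select (interleave blocks bits) (fill π g h)) ≡ β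

  blockOccurrence : ∀ g {h β} → IsGap π g → h ∈ perms (norm g) → Contains (fill π g h) β → BlockOccurrence g h β
  blockOccurrence g {h} gap h∈ c with contains⁻ c
  ... | s , s⊆ , occurs with ⊆⇒select s⊆
  ... | O , |O| , refl with split-interleave g k O gap (trans |O| (proj₂ (fill-isPerm π-perm g gap h∈)))
  ... | Os , bs , lens , |bs| , refl = record
    { blocks = Os ; bits = bs ; blocks-length = lens ; bits-length = |bs| ; mask-length = |O| ; occurs = occurs }

  -- An occurrence avoiding π(r) would survive the deletion of π(r), contradicting Goodᵈ.
  occurrence-uses-π[r] : ∀ g {h β} → IsGap π g → h ∈ perms (norm g) → Goodᵈ g h → β ∈ B →
    (occ : BlockOccurrence g h β) → bitAt (BlockOccurrence.bits occ) r ≡ true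
  occurrence-uses-π[r] g {h} gap h∈ goodᵈ β∈ occ with bitAt (BlockOccurrence.bits occ) r in bit
  ... | true  = refl
  ... | false = ⊥-elim (All.lookup goodᵈ β∈ (Contains-resp-≅ (≅-sym (fill-dπ-≅ π r g h π-perm 1≤r r≤k (positive (norm g) h∈)))
                  (contains⁺ (select-bitAt-false-⊆ r blocks bits Gs π bit (trans blocks-length (sym |Gs|)) bits-length 1≤r r≤k
                    (length-cut-gap π-perm g gap (map (k +_) h))) occurs)))
    where
    open BlockOccurrence occ
    Gs = cut g (map (k +_) h)
    |Gs| : map length Gs ≡ g
    |Gs| = map-length-cut g _ (trans (length-map _ h) (proj₂ (∈-perms⁻ h∈)))

  module Restriction (g : List ℕ) (gap : IsGap π g) (Os : List (List Bool)) (lens : map length Os ≡ g) where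

    g′ : List ℕ
    g′ = map countTrue Os

    restrict : List ℕ → List ℕ
    restrict h = st (select (concat Os) h)

    private
      |Os| : length Os ≡ suc k
      |Os| = trans (sym (length-map length Os)) (trans (cong length lens) gap)

      |h| : ∀ {h} → h ∈ perms (norm g) → length h ≡ sum (map length Os)
      |h| h∈ = trans (proj₂ (∈-perms⁻ {norm g} h∈)) (cong sum (sym lens))

      Os₂ = mergeAt r Os

      lens₂ : map length Os₂ ≡ dg r g
      lens₂ = trans (map-mergeAt length (λ X Y → length-++ X) r Os) (cong (dg r) lens)

      |Os₂| : length Os₂ ≡ suc (length τ)
      |Os₂| = trans (sym (length-map length Os₂)) (trans (cong length lens₂) (dg-gap g gap))

    gap′ : IsGap π g′
    gap′ = trans (length-map countTrue Os) |Os|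

    restrict-∈-perms : ∀ {h} → h ∈ perms (norm g) → restrict h ∈ perms (norm g′)
    restrict-∈-perms {h} h∈ = subst (λ n → restrict h ∈ perms n) |restrict-h|
      (∈-perms⁺ (st-isPerm (Unique-resp-⊇ (select-⊆ (concat Os) h) (proj₁ (proj₁ (∈-perms⁻ {norm g} h∈))))))
      where
      |restrict-h| : length (restrict h) ≡ norm g′
      |restrict-h| = trans (length-map _ (select (concat Os) h))
        (trans (length-select (concat Os) h (trans (length-concat Os) (sym (|h| h∈)))) (countTrue-concat Os))

    restrict-≅ : ∀ {h} → h ∈ perms (norm g) → fill π g′ (restrict h) ≅ select (interleave Os (replicate k true)) (fill π g h)
    restrict-≅ {h} h∈ = subst (λ t → fill π g′ (restrict h) ≅ select (interleave Os (replicate k true)) (fill π t h)) lens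
      (fill-select-≅ π Os h π≤k (positive (norm g) h∈) |Os| (|h| h∈))

    restrict-good : ∀ {h} → h ∈ perms (norm g) → Good g h → Good g′ (restrict h)
    restrict-good {h} h∈ good =
      AvoidsAll-resp-≅ (restrict-≅ h∈) (AvoidsAll-resp-⊇ (select-⊆ (interleave Os (replicate k true)) (fill π g h)) good)

    restrict-goodᵈ : ∀ {h} → h ∈ perms (norm g) → Goodᵈ g h → Goodᵈ g′ (restrict h)
    restrict-goodᵈ {h} h∈ goodᵈ =
      AvoidsAll-resp-≅ restricted-≅
        (AvoidsAll-resp-⊇ (select-⊆ (interleave Os₂ (replicate (length τ) true)) (fill τ (dg r g) h)) goodᵈ)
      where
      restricted-≅ : fill τ (dg r g′) (restrict h) ≅ select (interleave Os₂ (replicate (length τ) true)) (fill τ (dg r g) h)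
      restricted-≅ = subst₂ _≅_
        (cong₂ (λ g″ O → fill τ g″ (st (select O h))) (map-mergeAt countTrue countTrue-++ r Os) (concat-mergeAt r Os))
        (cong (λ g″ → select (interleave Os₂ (replicate (length τ) true)) (fill τ g″ h)) lens₂)
        (fill-select-≅ τ Os₂ h τ≤|τ| (positive (norm g) h∈) |Os₂|
          (trans (proj₂ (∈-perms⁻ {norm g} h∈)) (trans (sym (sum-dg r g)) (cong sum (sym lens₂)))))

    restrict-Z-nonempty : ¬ Z B π g ≡ [] → ¬ Z B π g′ ≡ []
    restrict-Z-nonempty Z≢[] with Z B π g in eq
    ... | []    = ⊥-elim (Z≢[] refl)
    ... | p ∷ _ with ∈-Z⁻ π-perm g gap B (subst (p ∈_) (sym eq) (here refl))
    ...   | h , h∈ , good , _ = ∈⇒≢[] (∈-Z⁺ π-perm g′ gap′ B (restrict-∈-perms h∈) (restrict-good h∈ good))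

    module _ {h β} (h∈ : h ∈ perms (norm g)) (bs : List Bool) (|bs| : length bs ≡ k)
             (|mask| : length (interleave Os bs) ≡ length (fill π g h))
             (occurs : st (select (interleave Os bs) (fill π g h)) ≡ β) where

      restrict-contains : Contains (fill π g′ (restrict h)) β
      restrict-contains = Contains-resp-≅ (≅-sym (restrict-≅ h∈))
        (contains⁺ (select-mono (subst (λ n → Pointwise _≤ᵇ_ (interleave Os bs) (interleave Os (replicate n true))) |bs|
          (interleave-≤ᵇ-trues Os bs)) (fill π g h) |mask|) occurs)

      restrict-norm : bitAt bs r ≡ true → norm g′ + 1 ≤ length β
      restrict-norm bit = begin
        norm g′ + 1                                     ≡⟨ cong (_+ 1) (countTrue-concat Os) ⟨
        countTrue (concat Os) + 1                       ≤⟨ +-monoʳ-≤ (countTrue (concat Os)) (bitAt-true⇒countTrue-positive r bs bit) ⟩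
        countTrue (concat Os) + countTrue bs            ≡⟨ countTrue-interleave Os bs (trans |Os| (cong suc (sym |bs|))) ⟨
        countTrue (interleave Os bs)                    ≡⟨ length-select (interleave Os bs) (fill π g h) |mask| ⟨
        length (select (interleave Os bs) (fill π g h)) ≡⟨ length-map _ (select (interleave Os bs) (fill π g h)) ⟨
        length (st (select (interleave Os bs) (fill π g h))) ≡⟨ cong length occurs ⟩
        length β ∎
        where open ≤-Reasoning

  -- Keep only the gap entries used by an occurrence of some β ∈ B in the witness: the restricted witness
  -- is still good for dπ and bad for π, and since the occurrence also uses π(r), ‖g′‖ + 1 ≤ |β|.
  shrink : ∀ {g} → Counterexample g → ∃ λ g′ → Counterexample g′ × norm g′ + 1 ≤ maxLen B
  shrink {g} ce with find (¬All⇒Any¬ (λ β → ¬? (contains? (fill π g (Counterexample.witness ce)) β)) B (Counterexample.¬good ce))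
  ... | β , β∈ , ¬¬contains = g′ , counterexample′ , ≤-trans (restrict-norm witness∈ bits bits-length mask-length occurs uses-π[r])
                                                            (length-≤-maxLen B β∈)
    where
    open Counterexample ce
    occ = blockOccurrence g gap witness∈ (decidable-stable (contains? (fill π g witness) β) ¬¬contains)
    open BlockOccurrence occ
    open Restriction g gap blocks blocks-length
    uses-π[r] = occurrence-uses-π[r] g gap witness∈ goodᵈ β∈ occ
    counterexample′ : Counterexample g′
    counterexample′ = record
      { gap        = gap′
      ; Z-nonempty = restrict-Z-nonempty Z-nonempty
      ; witness    = restrict witness
      ; witness∈   = restrict-∈-perms witness∈
      ; goodᵈ      = restrict-goodᵈ witness∈ goodᵈ
      ; ¬good      = λ good′ → All.lookup good′ β∈ (restrict-contains witness∈ bits bits-length mask-length occurs)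
      }

  bounded⇒ESPlusReducible : (∀ g → InG B π g → norm g + 1 ≤ maxLen B → cardZ B π g ≡ cardZ B τ (dg r g)) →
    ESPlusReducible B π r
  bounded⇒ESPlusReducible bounded g gap Z≢[] with cardZ-≡-or-counterexample g gap Z≢[]
  ... | inj₁ cardZ-≡ = cardZ-≡
  ... | inj₂ ce with shrink ce
  ...   | g′ , ce′ , norm≤ = ⊥-elim (<-irrefl (bounded g′ (gap′ , Z′-nonempty) norm≤) (counterexample⇒cardZ-< ce′))
    where open Counterexample ce′ renaming (gap to gap′; Z-nonempty to Z′-nonempty)

mainTheorem2 : (B : List (List ℕ)) → Unique B → All IsPerm B →
    (π : List ℕ) → IsPerm π → (r : ℕ) → 1 ≤ r → r ≤ length π →
    ESPlusReducible B π r ⇔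
      ((g : List ℕ) → InG B π g → norm g + 1 ≤ maxLen B →
        cardZ B π g ≡ cardZ B (dπ r π) (dg r g))
mainTheorem2 B _ _ π π-perm r 1≤r r≤k =
  mk⇔ (λ reducible g (gap , Z≢[]) _ → reducible g gap Z≢[]) (Reduction.bounded⇒ESPlusReducible B π-perm 1≤r r≤k)
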